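{- Let $n\ge1$, $\pi\in B_n$ and $a,b,c\in\pi[n]$. Then $\sum_{x\le y,\ x,y\in\{a,b,c\}}\alpha(x,y)\le 4$, where the sum runs over pairs $x\le y$ of elements of the set $\{a,b,c\}$ (including $x=y$).
   Context: $B_n$ is the group of permutations $\pi$ of $[-n,n]\setminus\{0\}$ with $\pi(-i)=-\pi(i)$; $\pi[n]=\{\pi(1),\dots,\pi(n)\}$. Let $\ell$ be the length with respect to the generators $s_0=t_{1,-1}$, $s_i=t_{i,i+1}t_{ -i,-(i+1)}$ ($1\le i\le n-1$), $t_{x,y}$ the transposition of $x,y$. For distinct $x,y\in[-n,n]\setminus\{0\}$ define $u_{x,y}$: if $x=-y$, $u_{x,y}=t_{x,-x}$; if $xy>0$ or $\pi^{ -1}(x)\pi^{ -1}(y)>0$, $u_{x,y}=t_{x,y}t_{ -x,-y}$; otherwise $u_{x,y}$ is undefined. The graph $\Gamma_-^B(\pi)$ has vertex set $[-n,n]\setminus\{0\}$, with $\{x,y\}$ an edge iff $u_{x,y}$ is defined and $\ell(u_{x,y}\pi)=\ell(\pi)-1$. Set $e(x,y)=1$ if $x,y$ are adjacent and $0$ otherwise, $e(x,x)=0$. For $x,y\in\pi[n]$ let $\alpha(x,y)=e(x,y)+e(x,-y)$. -}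

module Defs where

open import Data.Nat using (ℕ; zero; suc; _+_; _≤_)
open import Data.Fin using (Fin; inject₁) renaming (zero to fzero; suc to fsuc)
import Data.Fin as Fin
open import Data.Integer as ℤ using (ℤ; +_; -[1+_]; 0ℤ)
open import Data.List using (List; []; _∷_; length; map; concatMap; deduplicate)
open import Data.Nat.ListAction using (sum)
open import Data.Product using (Σ; ∃; _×_; _,_)
open import Data.Sum using (_⊎_)
open import Data.Bool using (if_then_else_)
open import Function using (_∘_; id)
open import Relation.Nullary using (Dec; yes; no; ¬_; does)
open import Relation.Binary.PropositionalEquality using (_≡_; _≢_; refl; cong)
open import Relation.Binary.Definitions using (DecidableEquality)

-- Elements of [-n,n] \ {0}:  pos i  is  +(i+1),  neg i  is  -(i+1).
data Sgn (n : ℕ) : Set where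
  pos : Fin n → Sgn n
  neg : Fin n → Sgn n

toℤ : ∀ {n} → Sgn n → ℤ
toℤ (pos i) = + suc (Fin.toℕ i)
toℤ (neg i) = -[1+ Fin.toℕ i ]

minus : ∀ {n} → Sgn n → Sgn n
minus (pos i) = neg i
minus (neg i) = pos i

_≟S_ : ∀ {n} → DecidableEquality (Sgn n)
pos i ≟S pos j with i Fin.≟ j
... | yes refl = yes refl
... | no ne = no λ { refl → ne refl }
pos i ≟S neg j = no λ ()
neg i ≟S pos j = no λ ()
neg i ≟S neg j with i Fin.≟ j
... | yes refl = yes refl
... | no ne = no λ { refl → ne refl }

record Bn (n : ℕ) : Set where
  field
    fun   : Sgn n → Sgn n
    inv   : Sgn n → Sgn n
    inv-l : ∀ x → fun (inv x) ≡ x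
    inv-r : ∀ x → inv (fun x) ≡ x
    odd   : ∀ x → fun (minus x) ≡ minus (fun x)
open Bn public

t : ∀ {n} → Sgn n → Sgn n → Sgn n → Sgn n
t x y z = if does (z ≟S x) then y else (if does (z ≟S y) then x else z)

-- Coxeter generators, indexed by Fin n:  index 0 is s_0 = t_{1,-1};
-- index i (1 ≤ i ≤ n-1) is s_i = t_{i,i+1} t_{-i,-(i+1)}.
gen : ∀ {n} → Fin n → Sgn n → Sgn n
gen {suc m} fzero = t (pos fzero) (neg fzero)
gen {suc m} (fsuc j) = t (pos (inject₁ j)) (pos (fsuc j)) ∘ t (neg (inject₁ j)) (neg (fsuc j))

evalW : ∀ {n} → List (Fin n) → Sgn n → Sgn n
evalW [] = id
evalW (k ∷ w) = gen k ∘ evalW w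

Represents : ∀ {n} → List (Fin n) → (Sgn n → Sgn n) → Set
Represents w f = ∀ x → evalW w x ≡ f x

IsLength : ∀ {n} → (Sgn n → Sgn n) → ℕ → Set
IsLength f k = (Σ _ λ w → length w ≡ k × Represents w f)
             × (∀ w → Represents w f → k ≤ length w)

UDefined : ∀ {n} → Bn n → Sgn n → Sgn n → Set
UDefined π x y = (x ≡ minus y)
               ⊎ (0ℤ ℤ.< toℤ x ℤ.* toℤ y)
               ⊎ (0ℤ ℤ.< toℤ (inv π x) ℤ.* toℤ (inv π y))

u : ∀ {n} → Sgn n → Sgn n → Sgn n → Sgn n
u x y = if does (x ≟S minus y) then t x (minus x) else (t x y ∘ t (minus x) (minus y))

Adj : ∀ {n} → Bn n → Sgn n → Sgn n → Set
Adj π x y = x ≢ y × UDefined π x y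
          × (∃ λ k → IsLength (fun π) (suc k) × IsLength (u x y ∘ fun π) k)

e : ∀ {n} {π : Bn n} → (∀ x y → Dec (Adj π x y)) → Sgn n → Sgn n → ℕ
e adj? x y = if does (adj? x y) then 1 else 0

α : ∀ {n} {π : Bn n} → (∀ x y → Dec (Adj π x y)) → Sgn n → Sgn n → ℕ
α {π = π} adj? x y = e {π = π} adj? x y + e {π = π} adj? x (minus y)

InImage : ∀ {n} → Bn n → Sgn n → Set
InImage π x = ∃ λ i → fun π (pos i) ≡ x

tripleSum : ∀ {n} {π : Bn n} → (∀ x y → Dec (Adj π x y)) → Sgn n → Sgn n → Sgn n → ℕ
tripleSum {π = π} adj? a b c =
  let S = deduplicate _≟S_ (a ∷ b ∷ c ∷ []) in
  sum (concatMap (λ x → map (λ y → if does (toℤ x ℤ.≤? toℤ y) then α {π = π} adj? x y else 0) S) S)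

module Submission where

-- Write σ = π⁻¹ and read σ through its window σ(1), …, σ(n).  Then u_{x,y}π corresponds to
-- σ u_{x,y}, which exchanges the window entries at positions |x| and |y| (negating both when x
-- and y have opposite signs), or negates the entry at |x| when y = -x.  The length is the type B
-- inversion number of the window, and its change splits into a local unit ±1 plus, for every other
-- position, a cross term of the same sign.  Hence ℓ(u_{x,y}π) = ℓ(π) - 1 forces the local term to be
-- -1 and all cross terms to vanish, in particular the one at the third element of {a, b, c}.  These
-- necessary conditions depend only on the signs of a, b, c and on the relative orders of their
-- positions and of their window values, and a computation over all these configurations bounds the
-- sum by 4.

open import Defs
open import Data.Bool using (Bool; true; false; if_then_else_; not; _∧_; _∨_; _xor_; T) renaming (_≟_ to _≟ᵇ_)
open import Data.Bool.Properties using (T-∧)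
open import Data.Empty using (⊥-elim)
open import Data.Fin as Fin using (Fin; inject₁; toℕ) renaming (zero to fzero; suc to fsuc)
open import Data.Fin.Induction using (<-weakInduction; >-weakInduction)
import Data.Fin.Properties as Finₚ
open import Data.Integer as ℤ using (ℤ; 0ℤ; 1ℤ; -1ℤ; _+_; _-_)
import Data.Integer.Properties as ℤₚ
open import Data.Integer.Tactic.RingSolver using (solve-∀)
open import Data.List using (List; []; _∷_; length; map; concatMap; filter; deduplicate)
import Data.List.Properties as Listₚ
open import Data.Nat as ℕ using (ℕ; zero; suc; _≤_; _<ᵇ_; z≤n; s≤s)
open import Data.Nat.ListAction using () renaming (sum to sumℕ)
import Data.Nat.Properties as ℕₚ
open import Data.Product using (Σ; _×_; _,_; proj₁; proj₂; swap; map₂)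
open import Data.Sum using (_⊎_; inj₁; inj₂)
open import Data.Unit using (tt)
open import Function using (_∘_; id)
open import Function.Bundles using (Equivalence)
open import Relation.Binary.Definitions using (tri<; tri≈; tri>)
open import Relation.Binary.PropositionalEquality
open import Relation.Nullary using (Dec; yes; no; ¬_; does)
open import Relation.Nullary.Decidable using (dec-true; dec-false; map′; _×-dec_; _⊎-dec_; _→-dec_; ¬?; T?; toWitness)
open import Algebra.Properties.CommutativeMonoid.Sum ℤₚ.+-0-commutativeMonoid using (sum; sum-cong-≗; ∑-distrib-+)

if-true : ∀ {A : Set} {b : Bool} {p q : A} → b ≡ true → (if b then p else q) ≡ p
if-true refl = refl

if-false : ∀ {A : Set} {b : Bool} {p q : A} → b ≡ false → (if b then p else q) ≡ q
if-false refl = refl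

cong₃ : ∀ {A B C D : Set} (g : A → B → C → D) {a a′ b b′ c c′} →
        a ≡ a′ → b ≡ b′ → c ≡ c′ → g a b c ≡ g a′ b′ c′
cong₃ g refl refl refl = refl

-- Signed values and the reflections u_{x,y}

minus-involutive : ∀ {n} (x : Sgn n) → minus (minus x) ≡ x
minus-involutive (pos i) = refl
minus-involutive (neg i) = refl

minus-injective : ∀ {n} {x y : Sgn n} → minus x ≡ minus y → x ≡ y
minus-injective {x = x} {y} e = trans (sym (minus-involutive x)) (trans (cong minus e) (minus-involutive y))

minus-swap : ∀ {n} {x y : Sgn n} → x ≡ minus y → minus x ≡ y
minus-swap {y = y} e = trans (cong minus e) (minus-involutive y)

sign : ∀ {n} → Sgn n → Bool
sign (pos _) = true
sign (neg _) = false

magnitude : ∀ {n} → Sgn n → Fin n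
magnitude (pos i) = i
magnitude (neg i) = i

x≢minus-x : ∀ {n} (x : Sgn n) → x ≢ minus x
x≢minus-x (pos i) ()
x≢minus-x (neg i) ()

t-left : ∀ {n} (x y : Sgn n) → t x y x ≡ y
t-left x y = if-true (dec-true (x ≟S x) refl)

t-right : ∀ {n} (x y : Sgn n) → t x y y ≡ x
t-right x y with y ≟S x
... | yes e = e
... | no _ = if-true (dec-true (y ≟S y) refl)

t-fixes : ∀ {n} {x y z : Sgn n} → z ≢ x → z ≢ y → t x y z ≡ z
t-fixes {x = x} {y} {z} z≢x z≢y rewrite dec-false (z ≟S x) z≢x | dec-false (z ≟S y) z≢y = refl

module Reflection {n : ℕ} (x y : Sgn n) (x≢y : x ≢ y) where

  u-x : u x y x ≡ y
  u-x with x ≟S minus y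
  ... | yes e = trans (t-left x (minus x)) (minus-swap e)
  ... | no x≢-y = trans (cong (t x y) (t-fixes (x≢minus-x x) x≢-y)) (t-left x y)

  u-y : u x y y ≡ x
  u-y with x ≟S minus y
  ... | yes e = trans (cong (t x (minus x)) (sym (minus-swap e))) (t-right x (minus x))
  ... | no x≢-y = trans (cong (t x y) (t-fixes (x≢-y ∘ sym ∘ minus-swap) (x≢minus-x y))) (t-right x y)

  u-minus-x : u x y (minus x) ≡ minus y
  u-minus-x with x ≟S minus y
  ... | yes e = trans (t-right x (minus x)) e
  ... | no x≢-y = trans (cong (t x y) (t-left (minus x) (minus y)))
                    (t-fixes (x≢-y ∘ sym) (x≢minus-x y ∘ sym))

  u-minus-y : u x y (minus y) ≡ minus x
  u-minus-y with x ≟S minus y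
  ... | yes e = trans (cong (t x (minus x)) (sym e)) (t-left x (minus x))
  ... | no x≢-y = trans (cong (t x y) (t-right (minus x) (minus y)))
                    (t-fixes (x≢minus-x x ∘ sym) (x≢-y ∘ sym ∘ minus-swap ∘ sym))

  u-fixes : ∀ {z} → z ≢ x → z ≢ y → z ≢ minus x → z ≢ minus y → u x y z ≡ z
  u-fixes z≢x z≢y z≢-x z≢-y with x ≟S minus y
  ... | yes _ = t-fixes z≢x z≢-x
  ... | no _ = trans (cong (t x y) (t-fixes z≢-x z≢-y)) (t-fixes z≢x z≢y)

  u-involutive : ∀ z → u x y (u x y z) ≡ z
  u-involutive z with z ≟S x
  ... | yes refl = trans (cong (u x y) u-x) u-y
  ... | no z≢x with z ≟S y
  ... | yes refl = trans (cong (u x y) u-y) u-x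
  ... | no z≢y with z ≟S minus x
  ... | yes refl = trans (cong (u x y) u-minus-x) u-minus-y
  ... | no z≢-x with z ≟S minus y
  ... | yes refl = trans (cong (u x y) u-minus-y) u-minus-x
  ... | no z≢-y = trans (cong (u x y) fixed) fixed
    where fixed = u-fixes z≢x z≢y z≢-x z≢-y

  u-odd : ∀ z → u x y (minus z) ≡ minus (u x y z)
  u-odd z with z ≟S x
  ... | yes refl = trans u-minus-x (cong minus (sym u-x))
  ... | no z≢x with z ≟S y
  ... | yes refl = trans u-minus-y (cong minus (sym u-y))
  ... | no z≢y with z ≟S minus x
  ... | yes refl = trans (cong (u x y) (minus-involutive x)) (trans u-x (sym (minus-swap u-minus-x)))
  ... | no z≢-x with z ≟S minus y
  ... | yes refl = trans (cong (u x y) (minus-involutive y)) (trans u-y (sym (minus-swap u-minus-y)))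
  ... | no z≢-y = trans (u-fixes (z≢-x ∘ sym ∘ minus-swap ∘ sym) (z≢-y ∘ sym ∘ minus-swap ∘ sym)
                                 (z≢x ∘ minus-injective) (z≢y ∘ minus-injective))
                        (cong minus (sym (u-fixes z≢x z≢y z≢-x z≢-y)))

  u-injective : ∀ {z w} → u x y z ≡ u x y w → z ≡ w
  u-injective {z} {w} e = trans (sym (u-involutive z)) (trans (cong (u x y) e) (u-involutive w))

open Reflection public

genLeft genRight : ∀ {n} → Fin n → Sgn n
genLeft {suc m} fzero = pos fzero
genLeft {suc m} (fsuc j) = pos (inject₁ j)
genRight {suc m} fzero = neg fzero
genRight {suc m} (fsuc j) = pos (fsuc j)

inject₁≢suc : ∀ {m} (j : Fin m) → inject₁ j ≢ fsuc j
inject₁≢suc j e = ℕₚ.1+n≢n (sym (trans (sym (Finₚ.toℕ-inject₁ j)) (cong toℕ e)))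

genLeft≢genRight : ∀ {n} (k : Fin n) → genLeft k ≢ genRight k
genLeft≢genRight {suc m} fzero ()
genLeft≢genRight {suc m} (fsuc j) e = inject₁≢suc j (cong magnitude e)

gen-as-u : ∀ {n} (k : Fin n) z → gen k z ≡ u (genLeft k) (genRight k) z
gen-as-u {suc m} fzero z with pos {suc m} fzero ≟S pos fzero
... | yes _ = refl
... | no p≢p = ⊥-elim (p≢p refl)
gen-as-u {suc m} (fsuc j) z = refl

gen-involutive : ∀ {n} (k : Fin n) z → gen k (gen k z) ≡ z
gen-involutive k z = begin
  gen k (gen k z)        ≡⟨ gen-as-u k (gen k z) ⟩
  u x y (gen k z)        ≡⟨ cong (u x y) (gen-as-u k z) ⟩
  u x y (u x y z)        ≡⟨ u-involutive x y (genLeft≢genRight k) z ⟩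
  z                      ∎
  where
    open ≡-Reasoning
    x y : Sgn _
    x = genLeft k
    y = genRight k

gen-odd : ∀ {n} (k : Fin n) z → gen k (minus z) ≡ minus (gen k z)
gen-odd k z = trans (gen-as-u k (minus z))
  (trans (u-odd (genLeft k) (genRight k) (genLeft≢genRight k) z) (cong minus (sym (gen-as-u k z))))

-- Finite sums over Fin n

sum-distrib-- : ∀ {n} (f g : Fin n → ℤ) → sum (λ k → f k - g k) ≡ sum f - sum g
sum-distrib-- {zero} f g = refl
sum-distrib-- {suc n} f g = trans (cong ((f fzero - g fzero) +_) (sum-distrib-- (f ∘ fsuc) (g ∘ fsuc)))
                                  (interchange (f fzero) (g fzero) (sum (f ∘ fsuc)) (sum (g ∘ fsuc)))
  where
    interchange : ∀ a b c d → (a - b) + (c - d) ≡ (a + c) - (b + d)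
    interchange = solve-∀

sum-zero : ∀ {n} {f : Fin n → ℤ} → (∀ k → f k ≡ 0ℤ) → sum f ≡ 0ℤ
sum-zero {zero} f≡0 = refl
sum-zero {suc n} f≡0 = cong₂ _+_ (f≡0 fzero) (sum-zero (f≡0 ∘ fsuc))

sum-nonneg : ∀ {n} {f : Fin n → ℤ} → (∀ k → 0ℤ ℤ.≤ f k) → 0ℤ ℤ.≤ sum f
sum-nonneg {zero} f≥0 = ℤ.+≤+ z≤n
sum-nonneg {suc n} f≥0 = ℤₚ.+-mono-≤ (f≥0 fzero) (sum-nonneg (f≥0 ∘ fsuc))

sum-nonpos : ∀ {n} {f : Fin n → ℤ} → (∀ k → f k ℤ.≤ 0ℤ) → sum f ℤ.≤ 0ℤ
sum-nonpos {zero} f≤0 = ℤ.+≤+ z≤n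
sum-nonpos {suc n} f≤0 = ℤₚ.+-mono-≤ (f≤0 fzero) (sum-nonpos (f≤0 ∘ fsuc))

nonpos-sum-zero : ∀ {a b} → a ℤ.≤ 0ℤ → b ℤ.≤ 0ℤ → a + b ≡ 0ℤ → a ≡ 0ℤ × b ≡ 0ℤ
nonpos-sum-zero {a} {b} a≤0 b≤0 a+b≡0 = a≡0 , trans (sym (ℤₚ.+-identityˡ b)) (trans (cong (_+ b) (sym a≡0)) a+b≡0)
  where
    a≡0 : a ≡ 0ℤ
    a≡0 = ℤₚ.≤-antisym a≤0 (subst₂ ℤ._≤_ a+b≡0 (ℤₚ.+-identityʳ a) (ℤₚ.+-monoʳ-≤ a b≤0))

sum-nonpos-zero : ∀ {n} {f : Fin n → ℤ} → (∀ k → f k ℤ.≤ 0ℤ) → sum f ≡ 0ℤ → ∀ k → f k ≡ 0ℤ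
sum-nonpos-zero {suc n} f≤0 sum≡0 fzero = proj₁ (nonpos-sum-zero (f≤0 fzero) (sum-nonpos (f≤0 ∘ fsuc)) sum≡0)
sum-nonpos-zero {suc n} f≤0 sum≡0 (fsuc k) =
  sum-nonpos-zero (f≤0 ∘ fsuc) (proj₂ (nonpos-sum-zero (f≤0 fzero) (sum-nonpos (f≤0 ∘ fsuc)) sum≡0)) k

sum-single : ∀ {n} (i : Fin n) (f : Fin n → ℤ) → (∀ k → k ≢ i → f k ≡ 0ℤ) → sum f ≡ f i
sum-single {suc n} fzero f off≡0 =
  trans (cong (f fzero +_) (sum-zero (λ k → off≡0 (fsuc k) λ ()))) (ℤₚ.+-identityʳ _)
sum-single {suc n} (fsuc i) f off≡0 =
  trans (cong (_+ sum (f ∘ fsuc)) (off≡0 fzero λ ()))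
        (trans (ℤₚ.+-identityˡ _) (sum-single i (f ∘ fsuc) (λ k k≢i → off≡0 (fsuc k) (k≢i ∘ Finₚ.suc-injective))))

zeroAt : ∀ {n} → Fin n → (Fin n → ℤ) → Fin n → ℤ
zeroAt i f k = if does (k Fin.≟ i) then 0ℤ else f k

zeroAt-other : ∀ {n} {i k : Fin n} (f : Fin n → ℤ) → k ≢ i → zeroAt i f k ≡ f k
zeroAt-other {i = i} {k} f k≢i = if-false (dec-false (k Fin.≟ i) k≢i)

zeroAt-elim : ∀ {n} {P : ℤ → Set} (i : Fin n) {f : Fin n → ℤ} k → P 0ℤ → (k ≢ i → P (f k)) → P (zeroAt i f k)
zeroAt-elim i k P0 Pf with k Fin.≟ i
... | yes _ = P0
... | no k≢i = Pf k≢i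

zeroAt-cong : ∀ {n} (i : Fin n) {f g : Fin n → ℤ} k → (k ≢ i → f k ≡ g k) → zeroAt i f k ≡ zeroAt i g k
zeroAt-cong i k f≡g with k Fin.≟ i
... | yes _ = refl
... | no k≢i = f≡g k≢i

zeroAt-+ : ∀ {n} (i : Fin n) (f g : Fin n → ℤ) → ∀ k → zeroAt i (λ r → f r + g r) k ≡ zeroAt i f k + zeroAt i g k
zeroAt-+ i f g k with k Fin.≟ i
... | yes _ = refl
... | no _ = refl

sum-zeroAt : ∀ {n} (i : Fin n) (f : Fin n → ℤ) → sum f ≡ f i + sum (zeroAt i f)
sum-zeroAt i f = begin
  sum f                                   ≡⟨ sum-cong-≗ split ⟩
  sum (λ k → atI k + zeroAt i f k)        ≡⟨ ∑-distrib-+ atI (zeroAt i f) ⟩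
  sum atI + sum (zeroAt i f)              ≡⟨ cong (_+ sum (zeroAt i f)) (sum-single i atI atI-off) ⟩
  atI i + sum (zeroAt i f)                ≡⟨ cong (_+ sum (zeroAt i f)) (if-true (dec-true (i Fin.≟ i) refl)) ⟩
  f i + sum (zeroAt i f)                  ∎
  where
    open ≡-Reasoning
    atI : Fin _ → ℤ
    atI k = if does (k Fin.≟ i) then f k else 0ℤ
    split : ∀ k → f k ≡ atI k + zeroAt i f k
    split k with k Fin.≟ i
    ... | yes _ = sym (ℤₚ.+-identityʳ _)
    ... | no _ = sym (ℤₚ.+-identityˡ _)
    atI-off : ∀ k → k ≢ i → atI k ≡ 0ℤ
    atI-off k k≢i = if-false (dec-false (k Fin.≟ i) k≢i)

zeroAt₂ : ∀ {n} → Fin n → Fin n → (Fin n → ℤ) → Fin n → ℤ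
zeroAt₂ i j f = zeroAt j (zeroAt i f)

sum-zeroAt₂ : ∀ {n} {i j : Fin n} → i ≢ j → (f : Fin n → ℤ) → sum f ≡ f i + f j + sum (zeroAt₂ i j f)
sum-zeroAt₂ {i = i} {j} i≢j f = begin
  sum f                                        ≡⟨ sum-zeroAt i f ⟩
  f i + sum (zeroAt i f)                       ≡⟨ cong (f i +_) (sum-zeroAt j (zeroAt i f)) ⟩
  f i + (zeroAt i f j + sum (zeroAt₂ i j f))   ≡⟨ cong (λ v → f i + (v + sum (zeroAt₂ i j f))) (zeroAt-other f (i≢j ∘ sym)) ⟩
  f i + (f j + sum (zeroAt₂ i j f))            ≡⟨ sym (ℤₚ.+-assoc (f i) (f j) _) ⟩
  f i + f j + sum (zeroAt₂ i j f)              ∎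
  where open ≡-Reasoning

zeroAt₂-elim : ∀ {n} {P : ℤ → Set} (i j : Fin n) {f : Fin n → ℤ} k →
               P 0ℤ → (k ≢ i → k ≢ j → P (f k)) → P (zeroAt₂ i j f k)
zeroAt₂-elim {P = P} i j {f} k P0 Pf =
  zeroAt-elim {P = P} j {zeroAt i f} k P0 (λ k≢j → zeroAt-elim {P = P} i {f} k P0 (λ k≢i → Pf k≢i k≢j))

zeroAt₂-other : ∀ {n} {i j k : Fin n} (f : Fin n → ℤ) → k ≢ i → k ≢ j → zeroAt₂ i j f k ≡ f k
zeroAt₂-other {i = i} f k≢i k≢j = trans (zeroAt-other (zeroAt i f) k≢j) (zeroAt-other f k≢i)

sum-zeroAt₂-cong : ∀ {n} (i j : Fin n) {f g : Fin n → ℤ} → (∀ k → k ≢ i → k ≢ j → f k ≡ g k) →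
                   sum (zeroAt₂ i j f) ≡ sum (zeroAt₂ i j g)
sum-zeroAt₂-cong i j {f} {g} f≡g =
  sum-cong-≗ λ k → zeroAt-cong j {zeroAt i f} {zeroAt i g} k (λ k≢j → zeroAt-cong i {f} {g} k (λ k≢i → f≡g k k≢i k≢j))

sum-zeroAt₂-+ : ∀ {n} (i j : Fin n) (f g : Fin n → ℤ) →
                sum (zeroAt₂ i j (λ k → f k + g k)) ≡ sum (zeroAt₂ i j f) + sum (zeroAt₂ i j g)
sum-zeroAt₂-+ i j f g = trans (sum-cong-≗ pointwise) (∑-distrib-+ (zeroAt₂ i j f) (zeroAt₂ i j g))
  where
    pointwise : ∀ k → zeroAt₂ i j (λ k → f k + g k) k ≡ zeroAt₂ i j f k + zeroAt₂ i j g k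
    pointwise k = trans (zeroAt-cong j {zeroAt i (λ r → f r + g r)} {λ r → zeroAt i f r + zeroAt i g r} k (λ _ → zeroAt-+ i f g k))
                        (zeroAt-+ j (zeroAt i f) (zeroAt i g) k)

sum-zeroAt₂-zero : ∀ {n} (i j : Fin n) {f : Fin n → ℤ} → (∀ k → k ≢ i → k ≢ j → f k ≡ 0ℤ) →
                   sum (zeroAt₂ i j f) ≡ 0ℤ
sum-zeroAt₂-zero i j {f} f≡0 = sum-zero (λ k → zeroAt₂-elim {P = _≡ 0ℤ} i j {f} k refl (f≡0 k))

-- The inversion number of a window

SignedFin : ℕ → Set
SignedFin m = Bool × Fin m

flipIf : ∀ {m} → Bool → SignedFin m → SignedFin m
flipIf f (s , i) = f xor s , i

_<ᶠ_ : ∀ {n} → Fin n → Fin n → Bool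
i <ᶠ j = toℕ i <ᵇ toℕ j

<ᵇ-true : ∀ {m n} → m ℕ.< n → (m <ᵇ n) ≡ true
<ᵇ-true {zero} {suc n} _ = refl
<ᵇ-true {suc m} {suc n} (s≤s m<n) = <ᵇ-true m<n

<ᵇ-false : ∀ {m n} → n ≤ m → (m <ᵇ n) ≡ false
<ᵇ-false {m} {zero} _ = refl
<ᵇ-false {suc m} {suc n} (s≤s n≤m) = <ᵇ-false n≤m

<ᵇ-pair : ∀ {m n} → m ℕ.< n → (m <ᵇ n) ≡ true × (n <ᵇ m) ≡ false
<ᵇ-pair m<n = <ᵇ-true m<n , <ᵇ-false (ℕₚ.<⇒≤ m<n)

<ᵇ-asym : ∀ a b → (a <ᵇ b) ≡ true → (b <ᵇ a) ≡ false
<ᵇ-asym zero (suc b) _ = refl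
<ᵇ-asym (suc a) (suc b) a<b = <ᵇ-asym a b a<b

<ᶠ-irrefl : ∀ {n} (i : Fin n) → (i <ᶠ i) ≡ false
<ᶠ-irrefl i = <ᵇ-false {toℕ i} ℕₚ.≤-refl

⟦_⟧ : Bool → ℤ
⟦ true ⟧ = 1ℤ
⟦ false ⟧ = 0ℤ

⟦⟧-nonneg : ∀ b → 0ℤ ℤ.≤ ⟦ b ⟧
⟦⟧-nonneg true = ℤ.+≤+ z≤n
⟦⟧-nonneg false = ℤ.+≤+ z≤n

-- For a pair of window entries a (earlier) and b (later), given as signs and magnitude
-- comparisons: [a > b] and [a + b < 0].  Together with the number of negative entries
-- they give the length of a signed permutation (Björner–Brenti, Prop. 8.1.1).
greaterB negSumB : (sa sb a<b b<a : Bool) → Bool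
greaterB true true _ b<a = b<a
greaterB true false _ _ = true
greaterB false true _ _ = false
greaterB false false a<b _ = a<b
negSumB true true _ _ = false
negSumB false false _ _ = true
negSumB true false a<b _ = a<b
negSumB false true _ b<a = b<a

pairInversionsB : (sa sb a<b b<a : Bool) → ℤ
pairInversionsB sa sb a<b b<a = ⟦ greaterB sa sb a<b b<a ⟧ + ⟦ negSumB sa sb a<b b<a ⟧

pairInversions : ∀ {m} → SignedFin m → SignedFin m → ℤ
pairInversions (sa , a) (sb , b) = pairInversionsB sa sb (a <ᶠ b) (b <ᶠ a)

pairInversions-nonneg : ∀ {m} (a b : SignedFin m) → 0ℤ ℤ.≤ pairInversions a b
pairInversions-nonneg (sa , a) (sb , b) =
  ℤₚ.+-mono-≤ (⟦⟧-nonneg (greaterB sa sb (a <ᶠ b) (b <ᶠ a))) (⟦⟧-nonneg (negSumB sa sb (a <ᶠ b) (b <ᶠ a)))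

isNegative : ∀ {m} → SignedFin m → ℤ
isNegative (s , _) = ⟦ not s ⟧

inversionsAt : ∀ {n m} → (Fin n → SignedFin m) → Fin n → Fin n → ℤ
inversionsAt w r s = if r <ᶠ s then pairInversions (w r) (w s) else 0ℤ

inversionNumber : ∀ {n m} → (Fin n → SignedFin m) → ℤ
inversionNumber w = sum (λ r → sum (inversionsAt w r)) + sum (λ r → isNegative (w r))

inversionsAt-diagonal : ∀ {n m} (w : Fin n → SignedFin m) r → inversionsAt w r r ≡ 0ℤ
inversionsAt-diagonal w r = if-false (<ᶠ-irrefl r)

inversionNumber-nonneg : ∀ {n m} (w : Fin n → SignedFin m) → 0ℤ ℤ.≤ inversionNumber w
inversionNumber-nonneg w =
  ℤₚ.+-mono-≤ (sum-nonneg λ r → sum-nonneg (inversionsAt-nonneg r)) (sum-nonneg λ r → ⟦⟧-nonneg (not (proj₁ (w r))))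
  where
    inversionsAt-nonneg : ∀ r s → 0ℤ ℤ.≤ inversionsAt w r s
    inversionsAt-nonneg r s with r <ᶠ s
    ... | true = pairInversions-nonneg (w r) (w s)
    ... | false = ℤ.+≤+ z≤n

inversionNumber-cong : ∀ {n m} {w w′ : Fin n → SignedFin m} → (∀ r → w r ≡ w′ r) → inversionNumber w ≡ inversionNumber w′
inversionNumber-cong {w = w} {w′} w≡w′ =
  cong₂ _+_ (sum-cong-≗ λ r → sum-cong-≗ λ s → pointwise r s) (sum-cong-≗ (cong isNegative ∘ w≡w′))
  where
    pointwise : ∀ r s → inversionsAt w r s ≡ inversionsAt w′ r s
    pointwise r s rewrite w≡w′ r | w≡w′ s = refl

inversionNumber-difference : ∀ {n m} (w w′ : Fin n → SignedFin m) →
  inversionNumber w′ - inversionNumber w ≡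
  sum (λ r → sum (λ s → inversionsAt w′ r s - inversionsAt w r s)) + sum (λ r → isNegative (w′ r) - isNegative (w r))
inversionNumber-difference w w′ =
  trans (difference-of-sums (sum λ r → sum (inversionsAt w r)) (sum λ r → isNegative (w r))
                            (sum λ r → sum (inversionsAt w′ r)) (sum λ r → isNegative (w′ r)))
        (cong₂ _+_ (trans (sym (sum-distrib-- (λ r → sum (inversionsAt w′ r)) (λ r → sum (inversionsAt w r))))
                          (sum-cong-≗ λ r → sym (sum-distrib-- (inversionsAt w′ r) (inversionsAt w r))))
                   (sym (sum-distrib-- (λ r → isNegative (w′ r)) (λ r → isNegative (w r)))))
  where
    difference-of-sums : ∀ a b a′ b′ → (a′ + b′) - (a + b) ≡ (a′ - a) + (b′ - b)
    difference-of-sums = solve-∀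

pairChange : ∀ {m} (r<s : Bool) (a b a′ b′ : SignedFin m) → ℤ
pairChange r<s a b a′ b′ = (if r<s then pairInversions a′ b′ else 0ℤ) - (if r<s then pairInversions a b else 0ℤ)

module WindowChange₂ {n m} (w w′ : Fin n → SignedFin m) {i j : Fin n} (i≢j : i ≢ j)
                     (unchanged : ∀ k → k ≢ i → k ≢ j → w′ k ≡ w k) where

  Δ : Fin n → Fin n → ℤ
  Δ r s = pairChange (r <ᶠ s) (w r) (w s) (w′ r) (w′ s)

  Δneg : Fin n → ℤ
  Δneg r = isNegative (w′ r) - isNegative (w r)

  localChange : ℤ
  localChange = Δ i j + Δ j i + Δneg i + Δneg j

  crossChange : Fin n → ℤ
  crossChange k = Δ k i + Δ i k + Δ k j + Δ j k

  Δ-diagonal : ∀ r → Δ r r ≡ 0ℤ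
  Δ-diagonal r = cong₂ _-_ (inversionsAt-diagonal w′ r) (inversionsAt-diagonal w r)

  Δ-unchanged : ∀ {r s} → r ≢ i → r ≢ j → s ≢ i → s ≢ j → Δ r s ≡ 0ℤ
  Δ-unchanged {r} {s} r≢i r≢j s≢i s≢j = trans (cong (_- inversionsAt w r s) same) (ℤₚ.+-inverseʳ (inversionsAt w r s))
    where
      same : inversionsAt w′ r s ≡ inversionsAt w r s
      same rewrite unchanged r r≢i r≢j | unchanged s s≢i s≢j = refl

  row-unchanged : ∀ r → r ≢ i → r ≢ j → sum (Δ r) ≡ Δ r i + Δ r j
  row-unchanged r r≢i r≢j =
    trans (sum-zeroAt₂ i≢j (Δ r))
          (trans (cong (Δ r i + Δ r j +_) (sum-zeroAt₂-zero i j (λ s → Δ-unchanged r≢i r≢j))) (ℤₚ.+-identityʳ _))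

  Δneg-sum : sum Δneg ≡ Δneg i + Δneg j
  Δneg-sum = trans (sum-zeroAt₂ i≢j Δneg)
                   (trans (cong (Δneg i + Δneg j +_) (sum-zeroAt₂-zero i j unchangedSign)) (ℤₚ.+-identityʳ _))
    where
      unchangedSign : ∀ k → k ≢ i → k ≢ j → Δneg k ≡ 0ℤ
      unchangedSign k k≢i k≢j =
        trans (cong (λ v → isNegative v - isNegative (w k)) (unchanged k k≢i k≢j)) (ℤₚ.+-inverseʳ (isNegative (w k)))

  inversionNumber-change : inversionNumber w′ - inversionNumber w ≡ localChange + sum (zeroAt₂ i j crossChange)
  inversionNumber-change = begin
    inversionNumber w′ - inversionNumber w
      ≡⟨ inversionNumber-difference w w′ ⟩
    sum (λ r → sum (Δ r)) + sum Δneg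
      ≡⟨ cong₂ _+_ (sum-zeroAt₂ i≢j (λ r → sum (Δ r))) Δneg-sum ⟩
    (sum (Δ i) + sum (Δ j) + sum (zeroAt₂ i j (λ r → sum (Δ r)))) + (Δneg i + Δneg j)
      ≡⟨ cong (λ v → (sum (Δ i) + sum (Δ j) + v) + (Δneg i + Δneg j)) columns ⟩
    (sum (Δ i) + sum (Δ j) + (Cᵢ + Cⱼ)) + (Δneg i + Δneg j)
      ≡⟨ cong₂ (λ a b → (a + b + (Cᵢ + Cⱼ)) + (Δneg i + Δneg j)) (sum-zeroAt₂ i≢j (Δ i)) (sum-zeroAt₂ i≢j (Δ j)) ⟩
    ((Δ i i + Δ i j + Rᵢ) + (Δ j i + Δ j j + Rⱼ) + (Cᵢ + Cⱼ)) + (Δneg i + Δneg j)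
      ≡⟨ regroup (Δ i i) (Δ i j) Rᵢ (Δ j i) (Δ j j) Rⱼ Cᵢ Cⱼ (Δneg i) (Δneg j) ⟩
    localChange + (((Cᵢ + Rᵢ) + Cⱼ) + Rⱼ) + (Δ i i + Δ j j)
      ≡⟨ cong₂ (λ a b → localChange + a + b) (sym crossSum) (cong₂ _+_ (Δ-diagonal i) (Δ-diagonal j)) ⟩
    localChange + sum (zeroAt₂ i j crossChange) + 0ℤ
      ≡⟨ ℤₚ.+-identityʳ _ ⟩
    localChange + sum (zeroAt₂ i j crossChange)
      ∎
    where
      open ≡-Reasoning
      Rᵢ Rⱼ Cᵢ Cⱼ : ℤ
      Rᵢ = sum (zeroAt₂ i j (Δ i))
      Rⱼ = sum (zeroAt₂ i j (Δ j))
      Cᵢ = sum (zeroAt₂ i j (λ r → Δ r i))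
      Cⱼ = sum (zeroAt₂ i j (λ r → Δ r j))
      columns : sum (zeroAt₂ i j (λ r → sum (Δ r))) ≡ Cᵢ + Cⱼ
      columns = trans (sum-zeroAt₂-cong i j row-unchanged) (sum-zeroAt₂-+ i j (λ r → Δ r i) (λ r → Δ r j))
      crossSum : sum (zeroAt₂ i j crossChange) ≡ ((Cᵢ + Rᵢ) + Cⱼ) + Rⱼ
      crossSum = trans (sum-zeroAt₂-+ i j (λ k → Δ k i + Δ i k + Δ k j) (Δ j))
        (cong (_+ Rⱼ) (trans (sum-zeroAt₂-+ i j (λ k → Δ k i + Δ i k) (λ k → Δ k j))
          (cong (_+ Cⱼ) (sum-zeroAt₂-+ i j (λ k → Δ k i) (Δ i)))))
      regroup : ∀ dii dij ri dji djj rj ci cj ni nj →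
                ((dii + dij + ri) + (dji + djj + rj) + (ci + cj)) + (ni + nj)
                ≡ (dij + dji + ni + nj) + (((ci + ri) + cj) + rj) + (dii + djj)
      regroup = solve-∀

module WindowChange₁ {n m} (w w′ : Fin n → SignedFin m) (i : Fin n)
                     (unchanged : ∀ k → k ≢ i → w′ k ≡ w k) where

  Δ : Fin n → Fin n → ℤ
  Δ r s = pairChange (r <ᶠ s) (w r) (w s) (w′ r) (w′ s)

  localChange : ℤ
  localChange = isNegative (w′ i) - isNegative (w i)

  crossChange : Fin n → ℤ
  crossChange k = Δ k i + Δ i k

  Δ-unchanged : ∀ {r s} → r ≢ i → s ≢ i → Δ r s ≡ 0ℤ
  Δ-unchanged {r} {s} r≢i s≢i = trans (cong (_- inversionsAt w r s) same) (ℤₚ.+-inverseʳ (inversionsAt w r s))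
    where
      same : inversionsAt w′ r s ≡ inversionsAt w r s
      same rewrite unchanged r r≢i | unchanged s s≢i = refl

  row-unchanged : ∀ r → r ≢ i → sum (Δ r) ≡ Δ r i
  row-unchanged r r≢i =
    trans (sum-zeroAt i (Δ r))
          (trans (cong (Δ r i +_) (sum-zero λ s → zeroAt-elim {P = _≡ 0ℤ} i {Δ r} s refl (Δ-unchanged r≢i)))
                 (ℤₚ.+-identityʳ _))

  Δneg-sum : sum (λ r → isNegative (w′ r) - isNegative (w r)) ≡ localChange
  Δneg-sum = sum-single i _ unchangedSign
    where
      unchangedSign : ∀ k → k ≢ i → isNegative (w′ k) - isNegative (w k) ≡ 0ℤ
      unchangedSign k k≢i = trans (cong (λ v → isNegative v - isNegative (w k)) (unchanged k k≢i)) (ℤₚ.+-inverseʳ (isNegative (w k)))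

  inversionNumber-change : inversionNumber w′ - inversionNumber w ≡ localChange + sum (zeroAt i crossChange)
  inversionNumber-change = begin
    inversionNumber w′ - inversionNumber w
      ≡⟨ inversionNumber-difference w w′ ⟩
    sum (λ r → sum (Δ r)) + sum (λ r → isNegative (w′ r) - isNegative (w r))
      ≡⟨ cong₂ _+_ (sum-zeroAt i (λ r → sum (Δ r))) Δneg-sum ⟩
    (sum (Δ i) + sum (zeroAt i (λ r → sum (Δ r)))) + localChange
      ≡⟨ cong₂ (λ a b → (a + b) + localChange) (sum-zeroAt i (Δ i)) columns ⟩
    (Δ i i + R + C) + localChange
      ≡⟨ cong (λ v → (v + R + C) + localChange) (cong₂ _-_ (inversionsAt-diagonal w′ i) (inversionsAt-diagonal w i)) ⟩
    (0ℤ + R + C) + localChange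
      ≡⟨ regroup R C localChange ⟩
    localChange + (C + R)
      ≡⟨ cong (localChange +_) (sym crossSum) ⟩
    localChange + sum (zeroAt i crossChange)
      ∎
    where
      open ≡-Reasoning
      R C : ℤ
      R = sum (zeroAt i (Δ i))
      C = sum (zeroAt i (λ r → Δ r i))
      columns : sum (zeroAt i (λ r → sum (Δ r))) ≡ C
      columns = sum-cong-≗ λ k → zeroAt-cong i {λ r → sum (Δ r)} {λ r → Δ r i} k (row-unchanged k)
      crossSum : sum (zeroAt i crossChange) ≡ C + R
      crossSum = trans (sum-cong-≗ (zeroAt-+ i (λ k → Δ k i) (Δ i))) (∑-distrib-+ (zeroAt i (λ k → Δ k i)) (zeroAt i (Δ i)))
      regroup : ∀ a b c → (0ℤ + a + b) + c ≡ c + (b + a)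
      regroup = solve-∀

-- Signed permutations and their windows

record SignedPerm (n : ℕ) : Set where
  field
    apply : Sgn n → Sgn n
    apply-odd : ∀ z → apply (minus z) ≡ minus (apply z)
    apply-injective : ∀ {z w} → apply z ≡ apply w → z ≡ w
open SignedPerm public

signed : ∀ {n} → Bool → Fin n → Sgn n
signed true i = pos i
signed false i = neg i

toSigned : ∀ {n} → Sgn n → SignedFin n
toSigned x = sign x , magnitude x

signed-toSigned : ∀ {n} (x : Sgn n) → x ≡ signed (sign x) (magnitude x)
signed-toSigned (pos i) = refl
signed-toSigned (neg i) = refl

magnitude-signed : ∀ {n} s (i : Fin n) → magnitude (signed s i) ≡ i
magnitude-signed true i = refl
magnitude-signed false i = refl

magnitude-minus : ∀ {n} (x : Sgn n) → magnitude (minus x) ≡ magnitude x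
magnitude-minus (pos i) = refl
magnitude-minus (neg i) = refl

toSigned-minus : ∀ {n} (x : Sgn n) → toSigned (minus x) ≡ flipIf true (toSigned x)
toSigned-minus (pos i) = refl
toSigned-minus (neg i) = refl

magnitude-≡ : ∀ {n} {a b : Sgn n} → magnitude a ≡ magnitude b → a ≡ b ⊎ a ≡ minus b
magnitude-≡ {a = pos i} {pos .i} refl = inj₁ refl
magnitude-≡ {a = pos i} {neg .i} refl = inj₂ refl
magnitude-≡ {a = neg i} {pos .i} refl = inj₂ refl
magnitude-≡ {a = neg i} {neg .i} refl = inj₁ refl

signed-≢ : ∀ {n} sx sy {X Y : Fin n} → X ≢ Y → signed sx X ≢ signed sy Y
signed-≢ sx sy {X} {Y} X≢Y e = X≢Y (trans (sym (magnitude-signed sx X)) (trans (cong magnitude e) (magnitude-signed sy Y)))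

window : ∀ {n} → SignedPerm n → Fin n → SignedFin n
window σ r = toSigned (apply σ (pos r))

windowSign : ∀ {n} → SignedPerm n → Fin n → Bool
windowSign σ r = proj₁ (window σ r)

windowMagnitude : ∀ {n} → SignedPerm n → Fin n → Fin n
windowMagnitude σ r = proj₂ (window σ r)

ℓ : ∀ {n} → SignedPerm n → ℤ
ℓ σ = inversionNumber (window σ)

ℓ-cong : ∀ {n} (σ σ′ : SignedPerm n) → (∀ r → apply σ (pos r) ≡ apply σ′ (pos r)) → ℓ σ ≡ ℓ σ′
ℓ-cong σ σ′ same = inversionNumber-cong (cong toSigned ∘ same)

windowMagnitude-injective : ∀ {n} (σ : SignedPerm n) {r s : Fin n} → r ≢ s → windowMagnitude σ r ≢ windowMagnitude σ s
windowMagnitude-injective σ {r} {s} r≢s e with magnitude-≡ {a = apply σ (pos r)} e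
... | inj₁ same = r≢s (cong magnitude (apply-injective σ same))
... | inj₂ opposite with apply-injective σ {pos r} {neg s} (trans opposite (sym (apply-odd σ (pos s))))
... | ()

window-minus : ∀ {n} (σ : SignedPerm n) z → toSigned (apply σ (minus z)) ≡ flipIf true (toSigned (apply σ z))
window-minus σ z = trans (cong toSigned (apply-odd σ z)) (toSigned-minus (apply σ z))

composeU : ∀ {n} → SignedPerm n → (x y : Sgn n) → x ≢ y → SignedPerm n
composeU σ x y x≢y = record
  { apply = apply σ ∘ u x y
  ; apply-odd = λ z → trans (cong (apply σ) (u-odd x y x≢y z)) (apply-odd σ (u x y z))
  ; apply-injective = u-injective x y x≢y ∘ apply-injective σ }

reflect₂ : ∀ {n} → SignedPerm n → (sx sy : Bool) {X Y : Fin n} → X ≢ Y → SignedPerm n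
reflect₂ σ sx sy X≢Y = composeU σ _ _ (signed-≢ sx sy X≢Y)

reflect₁ : ∀ {n} → SignedPerm n → (sx : Bool) (X : Fin n) → SignedPerm n
reflect₁ σ sx X = composeU σ (signed sx X) (minus (signed sx X)) (x≢minus-x (signed sx X))

reflect₂-unchanged : ∀ {n} (σ : SignedPerm n) sx sy {X Y : Fin n} (X≢Y : X ≢ Y) →
                     ∀ k → k ≢ X → k ≢ Y → window (reflect₂ σ sx sy X≢Y) k ≡ window σ k
reflect₂-unchanged {n} σ sx sy {X} {Y} X≢Y k k≢X k≢Y = cong (toSigned ∘ apply σ)
  (u-fixes x y (signed-≢ sx sy X≢Y) (avoid k≢X (magnitude-signed sx X)) (avoid k≢Y (magnitude-signed sy Y))
           (avoid k≢X (trans (magnitude-minus x) (magnitude-signed sx X))) (avoid k≢Y (trans (magnitude-minus y) (magnitude-signed sy Y))))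
  where
    x y : Sgn n
    x = signed sx X
    y = signed sy Y
    avoid : ∀ {z : Sgn n} {Z : Fin n} → k ≢ Z → magnitude z ≡ Z → pos k ≢ z
    avoid k≢Z mz≡Z e = k≢Z (trans (cong magnitude e) mz≡Z)

reflect₂-window : ∀ {n} (σ : SignedPerm n) sx sy {X Y : Fin n} (X≢Y : X ≢ Y) →
                  window (reflect₂ σ sx sy X≢Y) X ≡ flipIf (sx xor sy) (window σ Y)
                  × window (reflect₂ σ sx sy X≢Y) Y ≡ flipIf (sx xor sy) (window σ X)
reflect₂-window σ true true {X} {Y} X≢Y =
  cong (toSigned ∘ apply σ) (u-x (pos X) (pos Y) (signed-≢ true true X≢Y)) ,
  cong (toSigned ∘ apply σ) (u-y (pos X) (pos Y) (signed-≢ true true X≢Y))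
reflect₂-window σ false false {X} {Y} X≢Y =
  cong (toSigned ∘ apply σ) (u-minus-x (neg X) (neg Y) (signed-≢ false false X≢Y)) ,
  cong (toSigned ∘ apply σ) (u-minus-y (neg X) (neg Y) (signed-≢ false false X≢Y))
reflect₂-window σ true false {X} {Y} X≢Y =
  trans (cong (toSigned ∘ apply σ) (u-x (pos X) (neg Y) (signed-≢ true false X≢Y))) (window-minus σ (pos Y)) ,
  trans (cong (toSigned ∘ apply σ) (u-minus-y (pos X) (neg Y) (signed-≢ true false X≢Y))) (window-minus σ (pos X))
reflect₂-window σ false true {X} {Y} X≢Y =
  trans (cong (toSigned ∘ apply σ) (u-minus-x (neg X) (pos Y) (signed-≢ false true X≢Y))) (window-minus σ (pos Y)) ,
  trans (cong (toSigned ∘ apply σ) (u-y (neg X) (pos Y) (signed-≢ false true X≢Y))) (window-minus σ (pos X))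

reflect₁-unchanged : ∀ {n} (σ : SignedPerm n) sx (X : Fin n) → ∀ k → k ≢ X → window (reflect₁ σ sx X) k ≡ window σ k
reflect₁-unchanged {n} σ sx X k k≢X = cong (toSigned ∘ apply σ)
  (u-fixes x (minus x) (x≢minus-x x) (avoid mx) (avoid m-x) (avoid m-x) (avoid (trans (magnitude-minus (minus x)) m-x)))
  where
    x : Sgn n
    x = signed sx X
    mx : magnitude x ≡ X
    mx = magnitude-signed sx X
    m-x : magnitude (minus x) ≡ X
    m-x = trans (magnitude-minus x) mx
    avoid : ∀ {z : Sgn n} → magnitude z ≡ X → pos k ≢ z
    avoid mz≡X e = k≢X (trans (cong magnitude e) mz≡X)

reflect₁-window : ∀ {n} (σ : SignedPerm n) sx (X : Fin n) → window (reflect₁ σ sx X) X ≡ flipIf true (window σ X)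
reflect₁-window σ true X = trans (cong (toSigned ∘ apply σ) (u-x (pos X) (neg X) (x≢minus-x (pos X)))) (window-minus σ (pos X))
reflect₁-window σ false X = trans (cong (toSigned ∘ apply σ) (u-minus-x (neg X) (pos X) (x≢minus-x (neg X)))) (window-minus σ (pos X))

-- Comparison patterns and computed case checks

Cmp₂ : Set
Cmp₂ = Bool × Bool

Cmp₃ : Set
Cmp₃ = Bool × Bool × Bool × Bool × Bool × Bool

compare₂ : ∀ {n} → Fin n → Fin n → Cmp₂
compare₂ i j = i <ᶠ j , j <ᶠ i

compareℕ₃ : ℕ → ℕ → ℕ → Cmp₃
compareℕ₃ p q r = (p <ᵇ q) , (q <ᵇ p) , (p <ᵇ r) , (r <ᵇ p) , (q <ᵇ r) , (r <ᵇ q)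

compare₃ : ∀ {n} → Fin n → Fin n → Fin n → Cmp₃
compare₃ i j k = compareℕ₃ (toℕ i) (toℕ j) (toℕ k)

data Order₃ : Set where
  o012 o021 o102 o120 o201 o210 : Order₃

pattern₃ : Order₃ → Cmp₃
pattern₃ o012 = compareℕ₃ 0 1 2
pattern₃ o021 = compareℕ₃ 0 2 1
pattern₃ o102 = compareℕ₃ 1 0 2
pattern₃ o120 = compareℕ₃ 1 2 0
pattern₃ o201 = compareℕ₃ 2 0 1
pattern₃ o210 = compareℕ₃ 2 1 0

≡-Cmp₃ : ∀ {a b c d e f a′ b′ c′ d′ e′ f′ : Bool} → a ≡ a′ × b ≡ b′ → c ≡ c′ × d ≡ d′ → e ≡ e′ × f ≡ f′ →
       _≡_ {A = Cmp₃} (a , b , c , d , e , f) (a′ , b′ , c′ , d′ , e′ , f′)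
≡-Cmp₃ (refl , refl) (refl , refl) (refl , refl) = refl

order₃ : ∀ p q r → p ≢ q → p ≢ r → q ≢ r → Σ Order₃ λ o → compareℕ₃ p q r ≡ pattern₃ o
order₃ p q r p≢q p≢r q≢r with ℕₚ.<-cmp p q | ℕₚ.<-cmp p r | ℕₚ.<-cmp q r
... | tri≈ _ e _ | _ | _ = ⊥-elim (p≢q e)
... | _ | tri≈ _ e _ | _ = ⊥-elim (p≢r e)
... | _ | _ | tri≈ _ e _ = ⊥-elim (q≢r e)
... | tri< a _ _ | tri< b _ _ | tri< c _ _ = o012 , ≡-Cmp₃ (<ᵇ-pair a) (<ᵇ-pair b) (<ᵇ-pair c)
... | tri< a _ _ | tri< b _ _ | tri> _ _ c = o021 , ≡-Cmp₃ (<ᵇ-pair a) (<ᵇ-pair b) (swap (<ᵇ-pair c))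
... | tri< a _ _ | tri> _ _ b | tri< c _ _ = ⊥-elim (ℕₚ.<-asym (ℕₚ.<-trans a c) b)
... | tri< a _ _ | tri> _ _ b | tri> _ _ c = o120 , ≡-Cmp₃ (<ᵇ-pair a) (swap (<ᵇ-pair b)) (swap (<ᵇ-pair c))
... | tri> _ _ a | tri< b _ _ | tri< c _ _ = o102 , ≡-Cmp₃ (swap (<ᵇ-pair a)) (<ᵇ-pair b) (<ᵇ-pair c)
... | tri> _ _ a | tri< b _ _ | tri> _ _ c = ⊥-elim (ℕₚ.<-asym (ℕₚ.<-trans a b) c)
... | tri> _ _ a | tri> _ _ b | tri< c _ _ = o201 , ≡-Cmp₃ (swap (<ᵇ-pair a)) (swap (<ᵇ-pair b)) (<ᵇ-pair c)
... | tri> _ _ a | tri> _ _ b | tri> _ _ c = o210 , ≡-Cmp₃ (swap (<ᵇ-pair a)) (swap (<ᵇ-pair b)) (swap (<ᵇ-pair c))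

order₃ᶠ : ∀ {n} {i j k : Fin n} → i ≢ j → i ≢ k → j ≢ k → Σ Order₃ λ o → compare₃ i j k ≡ pattern₃ o
order₃ᶠ i≢j i≢k j≢k = order₃ _ _ _ (i≢j ∘ Finₚ.toℕ-injective) (i≢k ∘ Finₚ.toℕ-injective) (j≢k ∘ Finₚ.toℕ-injective)

order₂ : ∀ {n} {i j : Fin n} → i ≢ j → Σ Bool λ b → compare₂ i j ≡ (b , not b)
order₂ {i = i} {j} i≢j with ℕₚ.<-cmp (toℕ i) (toℕ j)
... | tri< i<j _ _ = true , cong₂ _,_ (<ᵇ-true i<j) (<ᵇ-false (ℕₚ.<⇒≤ i<j))
... | tri≈ _ e _ = ⊥-elim (i≢j (Finₚ.toℕ-injective e))
... | tri> _ _ j<i = false , cong₂ _,_ (<ᵇ-false (ℕₚ.<⇒≤ j<i)) (<ᵇ-true j<i)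

at-order₂ : ∀ {P : Cmp₂ → Set} → (∀ b → P (b , not b)) → ∀ {n} {i j : Fin n} → i ≢ j → P (compare₂ i j)
at-order₂ {P} P-holds i≢j with order₂ i≢j
... | b , e = subst P (sym e) (P-holds b)

at-order₃ : ∀ {P : Cmp₃ → Set} → (∀ o → P (pattern₃ o)) →
            ∀ {n} {i j k : Fin n} → i ≢ j → i ≢ k → j ≢ k → P (compare₃ i j k)
at-order₃ {P} P-holds i≢j i≢k j≢k with order₃ᶠ i≢j i≢k j≢k
... | o , e = subst P (sym e) (P-holds o)

∀-Bool? : ∀ {P : Bool → Set} → (∀ b → Dec (P b)) → Dec (∀ b → P b)
∀-Bool? P? = map′ (λ { (pt , pf) true → pt ; (pt , pf) false → pf }) (λ all → all true , all false) (P? true ×-dec P? false)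

∀-Order₃? : ∀ {P : Order₃ → Set} → (∀ o → Dec (P o)) → Dec (∀ o → P o)
∀-Order₃? P? =
  map′ (λ { (p₁ , p₂ , p₃ , p₄ , p₅ , p₆) → λ { o012 → p₁ ; o021 → p₂ ; o102 → p₃ ; o120 → p₄ ; o201 → p₅ ; o210 → p₆ } })
       (λ all → all o012 , all o021 , all o102 , all o120 , all o201 , all o210)
       (P? o012 ×-dec P? o021 ×-dec P? o102 ×-dec P? o120 ×-dec P? o201 ×-dec P? o210)

IsUnit : ℤ → Set
IsUnit x = x ≡ -1ℤ ⊎ x ≡ 1ℤ

isUnit? : ∀ x → Dec (IsUnit x)
isUnit? x = (x ℤ.≟ -1ℤ) ⊎-dec (x ℤ.≟ 1ℤ)

Aligned : ℤ → ℤ → Set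
Aligned loc w = (loc ≡ -1ℤ × w ℤ.≤ 0ℤ) ⊎ (loc ≡ 1ℤ × 0ℤ ℤ.≤ w)

aligned? : ∀ loc w → Dec (Aligned loc w)
aligned? loc w = ((loc ℤ.≟ -1ℤ) ×-dec (w ℤ.≤? 0ℤ)) ⊎-dec ((loc ℤ.≟ 1ℤ) ×-dec (0ℤ ℤ.≤? w))

aligned-zero : ∀ {loc} → IsUnit loc → Aligned loc 0ℤ
aligned-zero (inj₁ loc≡-1) = inj₁ (loc≡-1 , ℤₚ.≤-refl)
aligned-zero (inj₂ loc≡1) = inj₂ (loc≡1 , ℤₚ.≤-refl)

unshift : ∀ a b → b ≡ (a + b) - a
unshift = solve-∀

unit-descent : ∀ {n loc} {g : Fin n → ℤ} → IsUnit loc → (∀ k → Aligned loc (g k)) →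
               loc + sum g ≡ -1ℤ → loc ≡ -1ℤ × ∀ k → g k ≡ 0ℤ
unit-descent {loc = loc} {g} (inj₁ loc≡-1) aligned drop = loc≡-1 , sum-nonpos-zero nonpos sum≡0
  where
    nonpos : ∀ k → g k ℤ.≤ 0ℤ
    nonpos k with aligned k
    ... | inj₁ (_ , g≤0) = g≤0
    ... | inj₂ (loc≡1 , _) = ⊥-elim (-1≢1 (trans (sym loc≡-1) loc≡1))
      where -1≢1 : -1ℤ ≢ 1ℤ
            -1≢1 ()
    sum≡0 : sum g ≡ 0ℤ
    sum≡0 = trans (unshift loc (sum g)) (cong₂ _-_ drop loc≡-1)
unit-descent {g = g} (inj₂ refl) aligned drop =
  ⊥-elim (¬0≤-2 (subst (0ℤ ℤ.≤_) (trans (unshift 1ℤ (sum g)) (cong (_- 1ℤ) drop)) (sum-nonneg nonneg)))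
  where
    nonneg : ∀ k → 0ℤ ℤ.≤ g k
    nonneg k with aligned k
    ... | inj₁ (() , _)
    ... | inj₂ (_ , 0≤g) = 0≤g
    ¬0≤-2 : ¬ (0ℤ ℤ.≤ -1ℤ - 1ℤ)
    ¬0≤-2 ()

-- The change of the inversion number when the entries a = (sa, A) at X and b = (sb, B) at Y are
-- replaced by flipIf f b and flipIf f a (resp. when the entry at X is negated), written through the
-- comparisons of positions and of magnitudes only, so that its sign can be checked by enumeration.
-- The cross term collects the pairs formed with a further position k, with entry (sk, K).
swapLocalB : (f : Bool) → Cmp₂ → Cmp₂ → (sa sb : Bool) → ℤ
swapLocalB f (X<Y , Y<X) (a<b , b<a) sa sb =
    ((if X<Y then pairInversionsB (f xor sb) (f xor sa) b<a a<b else 0ℤ) - (if X<Y then pairInversionsB sa sb a<b b<a else 0ℤ))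
  + ((if Y<X then pairInversionsB (f xor sa) (f xor sb) a<b b<a else 0ℤ) - (if Y<X then pairInversionsB sb sa b<a a<b else 0ℤ))
  + (⟦ not (f xor sb) ⟧ - ⟦ not sa ⟧) + (⟦ not (f xor sa) ⟧ - ⟦ not sb ⟧)

swapCrossB : (f : Bool) → Cmp₃ → Cmp₃ → (sa sb sk : Bool) → ℤ
swapCrossB f (_ , _ , X<k , k<X , Y<k , k<Y) (_ , _ , a<k , k<a , b<k , k<b) sa sb sk =
    ((if k<X then pairInversionsB sk (f xor sb) k<b b<k else 0ℤ) - (if k<X then pairInversionsB sk sa k<a a<k else 0ℤ))
  + ((if X<k then pairInversionsB (f xor sb) sk b<k k<b else 0ℤ) - (if X<k then pairInversionsB sa sk a<k k<a else 0ℤ))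
  + ((if k<Y then pairInversionsB sk (f xor sa) k<a a<k else 0ℤ) - (if k<Y then pairInversionsB sk sb k<b b<k else 0ℤ))
  + ((if Y<k then pairInversionsB (f xor sa) sk a<k k<a else 0ℤ) - (if Y<k then pairInversionsB sb sk b<k k<b else 0ℤ))

negLocalB : (sa : Bool) → ℤ
negLocalB sa = ⟦ not (true xor sa) ⟧ - ⟦ not sa ⟧

negLocalB-unit : ∀ sa → IsUnit (negLocalB sa)
negLocalB-unit true = inj₂ refl
negLocalB-unit false = inj₁ refl

negCrossB : Cmp₂ → Cmp₂ → (sa sk : Bool) → ℤ
negCrossB (X<k , k<X) (a<k , k<a) sa sk =
    ((if k<X then pairInversionsB sk (true xor sa) k<a a<k else 0ℤ) - (if k<X then pairInversionsB sk sa k<a a<k else 0ℤ))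
  + ((if X<k then pairInversionsB (true xor sa) sk a<k k<a else 0ℤ) - (if X<k then pairInversionsB sa sk a<k k<a else 0ℤ))

first₂ : Cmp₃ → Cmp₂
first₂ (X<Y , Y<X , _) = X<Y , Y<X

between : Cmp₃ → Bool
between (_ , _ , X<k , k<X , Y<k , k<Y) = (X<k ∧ k<Y) ∨ (Y<k ∧ k<X)

-- For x, y of opposite signs (f = true), u_{x,y} is defined iff π⁻¹(x) and π⁻¹(y) have the same sign,
-- that is, iff the window entries at |x| and |y| have opposite signs.
Admissible : (f sa sb : Bool) → Set
Admissible f sa sb = T (not f ∨ (sa xor sb))

swapLocal-unit : ∀ f b₁ b₂ sa sb → Admissible f sa sb → IsUnit (swapLocalB f (b₁ , not b₁) (b₂ , not b₂) sa sb)
swapLocal-unit = toWitness {a? = ∀-Bool? λ f → ∀-Bool? λ b₁ → ∀-Bool? λ b₂ → ∀-Bool? λ sa → ∀-Bool? λ sb →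
  T? (not f ∨ (sa xor sb)) →-dec isUnit? (swapLocalB f (b₁ , not b₁) (b₂ , not b₂) sa sb)} tt

swapCross-aligned : ∀ f o₁ o₂ sa sb sk → Admissible f sa sb →
  Aligned (swapLocalB f (first₂ (pattern₃ o₁)) (first₂ (pattern₃ o₂)) sa sb) (swapCrossB f (pattern₃ o₁) (pattern₃ o₂) sa sb sk)
swapCross-aligned = toWitness {a? = ∀-Bool? λ f → ∀-Order₃? λ o₁ → ∀-Order₃? λ o₂ → ∀-Bool? λ sa → ∀-Bool? λ sb → ∀-Bool? λ sk →
  T? (not f ∨ (sa xor sb)) →-dec
  aligned? (swapLocalB f (first₂ (pattern₃ o₁)) (first₂ (pattern₃ o₂)) sa sb) (swapCrossB f (pattern₃ o₁) (pattern₃ o₂) sa sb sk)} tt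

swapCross-outside : ∀ o₁ o₂ sa sb sk → between (pattern₃ o₁) ≡ false →
                    swapCrossB false (pattern₃ o₁) (pattern₃ o₂) sa sb sk ≡ 0ℤ
swapCross-outside = toWitness {a? = ∀-Order₃? λ o₁ → ∀-Order₃? λ o₂ → ∀-Bool? λ sa → ∀-Bool? λ sb → ∀-Bool? λ sk →
  (between (pattern₃ o₁) ≟ᵇ false) →-dec (swapCrossB false (pattern₃ o₁) (pattern₃ o₂) sa sb sk ℤ.≟ 0ℤ)} tt

negCross-aligned : ∀ b₁ b₂ sa sk → Aligned (negLocalB sa) (negCrossB (b₁ , not b₁) (b₂ , not b₂) sa sk)
negCross-aligned = toWitness {a? = ∀-Bool? λ b₁ → ∀-Bool? λ b₂ → ∀-Bool? λ sa → ∀-Bool? λ sk →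
  aligned? (negLocalB sa) (negCrossB (b₁ , not b₁) (b₂ , not b₂) sa sk)} tt

negCross-right : ∀ b₂ sa sk → negCrossB (true , false) (b₂ , not b₂) sa sk ≡ 0ℤ
negCross-right = toWitness {a? = ∀-Bool? λ b₂ → ∀-Bool? λ sa → ∀-Bool? λ sk →
  negCrossB (true , false) (b₂ , not b₂) sa sk ℤ.≟ 0ℤ} tt

swapDescentB : (f : Bool) → Cmp₃ → Cmp₃ → (sa sb sk : Bool) → Bool
swapDescentB f P M sa sb sk =
  does (swapLocalB f (first₂ P) (first₂ M) sa sb ℤ.≟ -1ℤ) ∧ does (swapCrossB f P M sa sb sk ℤ.≟ 0ℤ)

negDescentB : (Pb Mb Pc Mc : Cmp₂) (sa sb sc : Bool) → Bool
negDescentB Pb Mb Pc Mc sa sb sc =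
  does (negLocalB sa ℤ.≟ -1ℤ) ∧ does (negCrossB Pb Mb sa sb ℤ.≟ 0ℤ) ∧ does (negCrossB Pc Mc sa sc ℤ.≟ 0ℤ)

T-≟ : ∀ {x y : ℤ} → x ≡ y → T (does (x ℤ.≟ y))
T-≟ {x} {y} e = subst T (sym (dec-true (x ℤ.≟ y) e)) tt

-- The change of ℓ under a reflection

module SwapChange {n} (σ : SignedPerm n) (sx sy : Bool) {X Y : Fin n} (X≢Y : X ≢ Y) where

  private
    f : Bool
    f = sx xor sy
    w : Fin n → SignedFin n
    w = window σ
    σ′ : SignedPerm n
    σ′ = reflect₂ σ sx sy X≢Y
    sgn : Fin n → Bool
    sgn = windowSign σ
    mag : Fin n → Fin n
    mag = windowMagnitude σ

  local : ℤ
  local = swapLocalB f (compare₂ X Y) (compare₂ (mag X) (mag Y)) (sgn X) (sgn Y)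

  cross : Fin n → ℤ
  cross k = swapCrossB f (compare₃ X Y k) (compare₃ (mag X) (mag Y) (mag k)) (sgn X) (sgn Y) (sgn k)

  open WindowChange₂ w (window σ′) X≢Y (reflect₂-unchanged σ sx sy X≢Y)

  ℓ-change : ℓ σ′ - ℓ σ ≡ local + sum (zeroAt₂ X Y cross)
  ℓ-change = trans inversionNumber-change (cong₂ _+_ local≡ (sum-zeroAt₂-cong X Y cross≡))
    where
      atX : window σ′ X ≡ flipIf f (w Y)
      atX = proj₁ (reflect₂-window σ sx sy X≢Y)
      atY : window σ′ Y ≡ flipIf f (w X)
      atY = proj₂ (reflect₂-window σ sx sy X≢Y)
      local≡ : localChange ≡ local
      local≡ = cong₂ (λ a′ b′ → pairChange (X <ᶠ Y) (w X) (w Y) a′ b′ + pairChange (Y <ᶠ X) (w Y) (w X) b′ a′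
                                 + (isNegative a′ - isNegative (w X)) + (isNegative b′ - isNegative (w Y))) atX atY
      cross≡ : ∀ k → k ≢ X → k ≢ Y → crossChange k ≡ cross k
      cross≡ k k≢X k≢Y =
        cong₃ (λ c′ a′ b′ → pairChange (k <ᶠ X) (w k) (w X) c′ a′ + pairChange (X <ᶠ k) (w X) (w k) a′ c′
                            + pairChange (k <ᶠ Y) (w k) (w Y) c′ b′ + pairChange (Y <ᶠ k) (w Y) (w k) b′ c′)
              (reflect₂-unchanged σ sx sy X≢Y k k≢X k≢Y) atX atY

  local-unit : Admissible f (sgn X) (sgn Y) → IsUnit local
  local-unit adm =
    at-order₂ {P = λ c → IsUnit (swapLocalB f (compare₂ X Y) c (sgn X) (sgn Y))}
      (λ b₂ → at-order₂ {P = λ c → IsUnit (swapLocalB f c (b₂ , not b₂) (sgn X) (sgn Y))}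
                (λ b₁ → swapLocal-unit f b₁ b₂ (sgn X) (sgn Y) adm) X≢Y)
      (windowMagnitude-injective σ X≢Y)

  cross-aligned : Admissible f (sgn X) (sgn Y) → ∀ k → k ≢ X → k ≢ Y → Aligned local (cross k)
  cross-aligned adm k k≢X k≢Y =
    at-order₃ {P = λ M → Aligned (swapLocalB f (compare₂ X Y) (first₂ M) (sgn X) (sgn Y))
                                 (swapCrossB f (compare₃ X Y k) M (sgn X) (sgn Y) (sgn k))}
      (λ o₂ → at-order₃ {P = λ P → Aligned (swapLocalB f (first₂ P) (first₂ (pattern₃ o₂)) (sgn X) (sgn Y))
                                           (swapCrossB f P (pattern₃ o₂) (sgn X) (sgn Y) (sgn k))}
                (λ o₁ → swapCross-aligned f o₁ o₂ (sgn X) (sgn Y) (sgn k) adm) X≢Y (≢-sym k≢X) (≢-sym k≢Y))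
      (windowMagnitude-injective σ X≢Y) (windowMagnitude-injective σ (≢-sym k≢X)) (windowMagnitude-injective σ (≢-sym k≢Y))

  descent : Admissible f (sgn X) (sgn Y) → ℓ σ′ - ℓ σ ≡ -1ℤ → local ≡ -1ℤ × ∀ k → k ≢ X → k ≢ Y → cross k ≡ 0ℤ
  descent adm drop =
    map₂ (λ vanish k k≢X k≢Y → trans (sym (zeroAt₂-other cross k≢X k≢Y)) (vanish k))
         (unit-descent {g = zeroAt₂ X Y cross} (local-unit adm)
            (λ k → zeroAt₂-elim {P = Aligned local} X Y {cross} k (aligned-zero (local-unit adm)) (cross-aligned adm k))
            (trans (sym ℓ-change) drop))

  descentB : Admissible f (sgn X) (sgn Y) → ℓ σ′ - ℓ σ ≡ -1ℤ →
             ∀ k → k ≢ X → k ≢ Y → T (swapDescentB f (compare₃ X Y k) (compare₃ (mag X) (mag Y) (mag k)) (sgn X) (sgn Y) (sgn k))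
  descentB adm drop k k≢X k≢Y =
    Equivalence.from T-∧ (T-≟ (proj₁ (descent adm drop)) , T-≟ (proj₂ (descent adm drop) k k≢X k≢Y))

module NegChange {n} (σ : SignedPerm n) (sx : Bool) (X : Fin n) where

  private
    w : Fin n → SignedFin n
    w = window σ
    σ′ : SignedPerm n
    σ′ = reflect₁ σ sx X
    sgn : Fin n → Bool
    sgn = windowSign σ
    mag : Fin n → Fin n
    mag = windowMagnitude σ

  local : ℤ
  local = negLocalB (sgn X)

  cross : Fin n → ℤ
  cross k = negCrossB (compare₂ X k) (compare₂ (mag X) (mag k)) (sgn X) (sgn k)

  open WindowChange₁ w (window σ′) X (reflect₁-unchanged σ sx X)

  ℓ-change : ℓ σ′ - ℓ σ ≡ local + sum (zeroAt X cross)
  ℓ-change = trans inversionNumber-change (cong₂ _+_ local≡ (sum-cong-≗ λ k → zeroAt-cong X {crossChange} {cross} k (cross≡ k)))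
    where
      atX : window σ′ X ≡ flipIf true (w X)
      atX = reflect₁-window σ sx X
      local≡ : localChange ≡ local
      local≡ = cong (λ a′ → isNegative a′ - isNegative (w X)) atX
      cross≡ : ∀ k → k ≢ X → crossChange k ≡ cross k
      cross≡ k k≢X = cong₂ (λ c′ a′ → pairChange (k <ᶠ X) (w k) (w X) c′ a′ + pairChange (X <ᶠ k) (w X) (w k) a′ c′)
                           (reflect₁-unchanged σ sx X k k≢X) atX

  cross-aligned : ∀ k → k ≢ X → Aligned local (cross k)
  cross-aligned k k≢X =
    at-order₂ {P = λ c → Aligned local (negCrossB (compare₂ X k) c (sgn X) (sgn k))}
      (λ b₂ → at-order₂ {P = λ c → Aligned local (negCrossB c (b₂ , not b₂) (sgn X) (sgn k))}
                (λ b₁ → negCross-aligned b₁ b₂ (sgn X) (sgn k)) (≢-sym k≢X))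
      (windowMagnitude-injective σ (≢-sym k≢X))

  descent : ℓ σ′ - ℓ σ ≡ -1ℤ → local ≡ -1ℤ × ∀ k → k ≢ X → cross k ≡ 0ℤ
  descent drop =
    map₂ (λ vanish k k≢X → trans (sym (zeroAt-other cross k≢X)) (vanish k))
         (unit-descent {g = zeroAt X cross} (negLocalB-unit (sgn X))
            (λ k → zeroAt-elim {P = Aligned local} X {cross} k (aligned-zero (negLocalB-unit (sgn X))) (cross-aligned k))
            (trans (sym ℓ-change) drop))

  descentB : ℓ σ′ - ℓ σ ≡ -1ℤ → ∀ k₁ k₂ → k₁ ≢ X → k₂ ≢ X →
             T (negDescentB (compare₂ X k₁) (compare₂ (mag X) (mag k₁)) (compare₂ X k₂) (compare₂ (mag X) (mag k₂))
                            (sgn X) (sgn k₁) (sgn k₂))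
  descentB drop k₁ k₂ k₁≢X k₂≢X =
    Equivalence.from T-∧ (T-≟ (proj₁ (descent drop)) ,
      Equivalence.from T-∧ (T-≟ (proj₂ (descent drop) k₁ k₁≢X) , T-≟ (proj₂ (descent drop) k₂ k₂≢X)))

-- ℓ is the Coxeter length

genReflect : ∀ {n} → SignedPerm n → Fin n → SignedPerm n
genReflect {suc m} σ fzero = reflect₁ σ true fzero
genReflect {suc m} σ (fsuc j) = reflect₂ σ true true (inject₁≢suc j)

apply-genReflect : ∀ {n} (σ : SignedPerm n) k z → apply (genReflect σ k) z ≡ apply σ (gen k z)
apply-genReflect {suc m} σ fzero z = cong (apply σ) (sym (gen-as-u fzero z))
apply-genReflect {suc m} σ (fsuc j) z = refl

genLocal : ∀ {n} → SignedPerm n → Fin n → ℤ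
genLocal {suc m} σ fzero = NegChange.local σ true fzero
genLocal {suc m} σ (fsuc j) = SwapChange.local σ true true (inject₁≢suc j)

genLocal-unit : ∀ {n} (σ : SignedPerm n) k → IsUnit (genLocal σ k)
genLocal-unit {suc m} σ fzero = negLocalB-unit (windowSign σ fzero)
genLocal-unit {suc m} σ (fsuc j) = SwapChange.local-unit σ true true (inject₁≢suc j) tt

between-adjacent : ∀ t c → (((t <ᵇ c) ∧ (c <ᵇ suc t)) ∨ ((suc t <ᵇ c) ∧ (c <ᵇ t))) ≡ false
between-adjacent zero zero = refl
between-adjacent zero (suc zero) = refl
between-adjacent zero (suc (suc c)) = refl
between-adjacent (suc t) zero = refl
between-adjacent (suc t) (suc c) = between-adjacent t c

-- Only the positions of a generator enter the change of ℓ, since no position lies strictly between them.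
ℓ-genReflect-change : ∀ {n} (σ : SignedPerm n) k → ℓ (genReflect σ k) - ℓ σ ≡ genLocal σ k
ℓ-genReflect-change {suc m} σ fzero =
  trans ℓ-change (trans (cong (local +_) (sum-zero λ k → zeroAt-elim {P = _≡ 0ℤ} fzero {cross} k refl (cross-right k)))
                        (ℤₚ.+-identityʳ local))
  where
    open NegChange σ true fzero
    cross-right : ∀ k → k ≢ fzero → cross k ≡ 0ℤ
    cross-right fzero k≢0 = ⊥-elim (k≢0 refl)
    cross-right (fsuc k) _ =
      at-order₂ {P = λ c → negCrossB (true , false) c (windowSign σ fzero) (windowSign σ (fsuc k)) ≡ 0ℤ}
        (λ b → negCross-right b (windowSign σ fzero) (windowSign σ (fsuc k))) (windowMagnitude-injective σ (λ ()))
ℓ-genReflect-change {suc m} σ (fsuc j) =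
  trans ℓ-change (trans (cong (local +_) (sum-zeroAt₂-zero X Y cross-outside)) (ℤₚ.+-identityʳ local))
  where
    X Y : Fin (suc m)
    X = inject₁ j
    Y = fsuc j
    open SwapChange σ true true (inject₁≢suc j)
    sgn : Fin (suc m) → Bool
    sgn = windowSign σ
    mag : Fin (suc m) → Fin (suc m)
    mag = windowMagnitude σ
    cross-outside : ∀ k → k ≢ X → k ≢ Y → cross k ≡ 0ℤ
    cross-outside k k≢X k≢Y =
      at-order₃ {P = λ c → between c ≡ false → swapCrossB false c (compare₃ (mag X) (mag Y) (mag k)) (sgn X) (sgn Y) (sgn k) ≡ 0ℤ}
        (λ o₁ → at-order₃ {P = λ c → between (pattern₃ o₁) ≡ false → swapCrossB false (pattern₃ o₁) c (sgn X) (sgn Y) (sgn k) ≡ 0ℤ}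
                  (λ o₂ → swapCross-outside o₁ o₂ (sgn X) (sgn Y) (sgn k))
                  (windowMagnitude-injective σ (inject₁≢suc j)) (windowMagnitude-injective σ (≢-sym k≢X))
                  (windowMagnitude-injective σ (≢-sym k≢Y)))
        (inject₁≢suc j) (≢-sym k≢X) (≢-sym k≢Y)
        (subst (λ t → (((t <ᵇ toℕ k) ∧ (toℕ k <ᵇ suc (toℕ j))) ∨ ((suc (toℕ j) <ᵇ toℕ k) ∧ (toℕ k <ᵇ t))) ≡ false)
               (sym (Finₚ.toℕ-inject₁ j)) (between-adjacent (toℕ j) (toℕ k)))

ℓ-genReflect : ∀ {n} (σ : SignedPerm n) k → ℓ (genReflect σ k) ≡ ℓ σ + genLocal σ k
ℓ-genReflect σ k = trans (shift (ℓ σ) (ℓ (genReflect σ k))) (cong (ℓ σ +_) (ℓ-genReflect-change σ k))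
  where
    shift : ∀ a b → b ≡ a + (b - a)
    shift = solve-∀

evalInverse : ∀ {n} → List (Fin n) → Sgn n → Sgn n
evalInverse [] = id
evalInverse (k ∷ w) = evalInverse w ∘ gen k

evalW-evalInverse : ∀ {n} (w : List (Fin n)) z → evalW w (evalInverse w z) ≡ z
evalW-evalInverse [] z = refl
evalW-evalInverse (k ∷ w) z = trans (cong (gen k) (evalW-evalInverse w (gen k z))) (gen-involutive k z)

evalInverse-evalW : ∀ {n} (w : List (Fin n)) z → evalInverse w (evalW w z) ≡ z
evalInverse-evalW [] z = refl
evalInverse-evalW (k ∷ w) z = trans (cong (evalInverse w) (gen-involutive k (evalW w z))) (evalInverse-evalW w z)

evalInverse-odd : ∀ {n} (w : List (Fin n)) z → evalInverse w (minus z) ≡ minus (evalInverse w z)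
evalInverse-odd [] z = refl
evalInverse-odd (k ∷ w) z = trans (cong (evalInverse w) (gen-odd k z)) (evalInverse-odd w (gen k z))

wordPerm : ∀ {n} → List (Fin n) → SignedPerm n
wordPerm w = record
  { apply = evalInverse w
  ; apply-odd = evalInverse-odd w
  ; apply-injective = λ {z} {z′} e → trans (sym (evalW-evalInverse w z)) (trans (cong (evalW w) e) (evalW-evalInverse w z′)) }

ℓ-identity : ∀ {n} (σ : SignedPerm n) → (∀ r → apply σ (pos r) ≡ pos r) → ℓ σ ≡ 0ℤ
ℓ-identity {n} σ fixes =
  trans (inversionNumber-cong (cong toSigned ∘ fixes))
        (cong₂ _+_ (sum-zero λ r → sum-zero λ s → no-inversion r s) (sum-zero {f = λ r → isNegative {n} (true , r)} λ _ → refl))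
  where
    no-inversion : ∀ (r s : Fin n) → inversionsAt (λ r → true , r) r s ≡ 0ℤ
    no-inversion r s with r <ᶠ s in r<s
    ... | true rewrite <ᵇ-asym (toℕ r) (toℕ s) r<s = refl
    ... | false = refl

ℓ-wordPerm-≤ : ∀ {n} (w : List (Fin n)) → ℓ (wordPerm w) ℤ.≤ ℤ.+ length w
ℓ-wordPerm-≤ {n} [] = ℤₚ.≤-reflexive (ℓ-identity (wordPerm {n} []) λ _ → refl)
ℓ-wordPerm-≤ (k ∷ w) = begin
  ℓ (wordPerm (k ∷ w))
    ≡⟨ ℓ-cong (wordPerm (k ∷ w)) (genReflect (wordPerm w) k) (λ r → sym (apply-genReflect (wordPerm w) k (pos r))) ⟩
  ℓ (genReflect (wordPerm w) k)           ≡⟨ ℓ-genReflect (wordPerm w) k ⟩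
  ℓ (wordPerm w) + genLocal (wordPerm w) k ≤⟨ ℤₚ.+-mono-≤ (ℓ-wordPerm-≤ w) (unit≤1 (genLocal-unit (wordPerm w) k)) ⟩
  ℤ.+ length w + 1ℤ                       ≡⟨ sym (ℤₚ.pos-+ (length w) 1) ⟩
  ℤ.+ (length w ℕ.+ 1)                    ≡⟨ cong ℤ.+_ (ℕₚ.+-comm (length w) 1) ⟩
  ℤ.+ length (k ∷ w)                      ∎
  where
    open ℤₚ.≤-Reasoning
    unit≤1 : ∀ {x} → IsUnit x → x ℤ.≤ 1ℤ
    unit≤1 (inj₁ refl) = ℤ.-≤+
    unit≤1 (inj₂ refl) = ℤₚ.≤-refl

increasing⇒toℕ : ∀ {m} (g : Fin (suc m) → ℕ) → (∀ k → g k ≤ m) → (∀ j → g (inject₁ j) ℕ.< g (fsuc j)) →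
                 ∀ k → g k ≡ toℕ k
increasing⇒toℕ {m} g bounded increasing k = ℕₚ.≤-antisym (upper k) (lower k)
  where
    upper : ∀ k → g k ≤ toℕ k
    upper = >-weakInduction (λ k → g k ≤ toℕ k) (subst (g (Fin.fromℕ m) ≤_) (sym (Finₚ.toℕ-fromℕ m)) (bounded _))
              (λ j h → subst (g (inject₁ j) ≤_) (sym (Finₚ.toℕ-inject₁ j)) (ℕₚ.<⇒≤pred (ℕₚ.<-≤-trans (increasing j) h)))
    lower : ∀ k → toℕ k ≤ g k
    lower = <-weakInduction (λ k → toℕ k ≤ g k) z≤n
              (λ j h → ℕₚ.<-≤-trans (s≤s (subst (_≤ g (inject₁ j)) (Finₚ.toℕ-inject₁ j) h)) (increasing j))

compare₂-adjacent : ∀ {m} (j : Fin m) → compare₂ (inject₁ j) (fsuc j) ≡ (true , false)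
compare₂-adjacent j = cong₂ _,_ (<ᵇ-true (s≤s (ℕₚ.≤-reflexive (Finₚ.toℕ-inject₁ j))))
                               (<ᵇ-false (ℕₚ.≤-trans (ℕₚ.≤-reflexive (Finₚ.toℕ-inject₁ j)) (ℕₚ.n≤1+n (toℕ j))))

ascent-step : ∀ sb b → swapLocalB false (true , false) (b , not b) true sb ≡ 1ℤ → sb ≡ true × b ≡ true
ascent-step true true _ = refl , refl
ascent-step true false ()
ascent-step false true ()
ascent-step false false ()

-- Without descents the window is 1, 2, …, n: all entries positive (s₀) and increasing (s₁, …, s_{n-1}).
noDescent⇒identity : ∀ {n} (σ : SignedPerm n) → (∀ k → genLocal σ k ≢ -1ℤ) → ∀ r → apply σ (pos r) ≡ pos r
noDescent⇒identity {suc m} σ noDescent r =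
  trans (signed-toSigned (apply σ (pos r))) (cong₂ signed (all-positive r) (magnitude-identity r))
  where
    ascent : ∀ k → genLocal σ k ≡ 1ℤ
    ascent k with genLocal-unit σ k
    ... | inj₁ descent = ⊥-elim (noDescent k descent)
    ... | inj₂ ascent = ascent
    step : ∀ j → windowSign σ (inject₁ j) ≡ true →
           windowSign σ (fsuc j) ≡ true × (windowMagnitude σ (inject₁ j) <ᶠ windowMagnitude σ (fsuc j)) ≡ true
    step j positive with order₂ (windowMagnitude-injective σ (inject₁≢suc j)) | ascent (fsuc j)
    ... | b , mags | local≡1 =
      map₂ (trans (cong proj₁ mags))
           (ascent-step (windowSign σ (fsuc j)) b
              (subst (λ s → swapLocalB false (true , false) (b , not b) s (windowSign σ (fsuc j)) ≡ 1ℤ) positive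
                 (subst₂ (λ c₁ c₂ → swapLocalB false c₁ c₂ (windowSign σ (inject₁ j)) (windowSign σ (fsuc j)) ≡ 1ℤ)
                         (compare₂-adjacent j) mags local≡1)))
    first-positive : windowSign σ fzero ≡ true
    first-positive with windowSign σ fzero | ascent fzero
    ... | true | _ = refl
    ... | false | ()
    all-positive : ∀ k → windowSign σ k ≡ true
    all-positive = <-weakInduction (λ k → windowSign σ k ≡ true) first-positive (λ j → proj₁ ∘ step j)
    magnitude-identity : ∀ k → windowMagnitude σ k ≡ k
    magnitude-identity k = Finₚ.toℕ-injective
      (increasing⇒toℕ (toℕ ∘ windowMagnitude σ) (λ k → ℕₚ.<⇒≤pred (Finₚ.toℕ<n (windowMagnitude σ k)))
                      (λ j → ℕₚ.<ᵇ⇒< _ _ (subst T (sym (proj₂ (step j (all-positive (inject₁ j))))) tt)) k)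

identity-everywhere : ∀ {n} (σ : SignedPerm n) → (∀ r → apply σ (pos r) ≡ pos r) → ∀ z → apply σ z ≡ z
identity-everywhere σ fixes (pos r) = fixes r
identity-everywhere σ fixes (neg r) = trans (apply-odd σ (pos r)) (cong minus (fixes r))

reducedWord : ∀ {n} m (σ : SignedPerm n) → ℓ σ ≡ ℤ.+ m →
              Σ (List (Fin n)) λ w → length w ≡ m × (∀ z → evalInverse w z ≡ apply σ z)
reducedWord zero σ ℓ≡0 = [] , refl , λ z → sym (identity-everywhere σ (noDescent⇒identity σ noDescent) z)
  where
    noDescent : ∀ k → genLocal σ k ≢ -1ℤ
    noDescent k descent with trans (ℓ-genReflect σ k) (cong₂ _+_ ℓ≡0 descent) | inversionNumber-nonneg (window (genReflect σ k))
    ... | ℓ≡-1 | 0≤ℓ with () ← subst (0ℤ ℤ.≤_) ℓ≡-1 0≤ℓ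
reducedWord (suc m) σ ℓ≡1+m with Finₚ.any? (λ k → genLocal σ k ℤ.≟ -1ℤ)
... | yes (k , descent) with reducedWord m (genReflect σ k) (trans (ℓ-genReflect σ k) (cong₂ _+_ ℓ≡1+m descent))
...   | w , length≡m , evaluates =
  k ∷ w , cong suc length≡m ,
  λ z → trans (evaluates (gen k z)) (trans (apply-genReflect σ k (gen k z)) (cong (apply σ) (gen-involutive k z)))
reducedWord (suc m) σ ℓ≡1+m | no noDescent
  with () ← trans (sym ℓ≡1+m) (ℓ-identity σ (noDescent⇒identity σ λ k descent → noDescent (k , descent)))

-- Each generator changes ℓ by one, and away from the identity some generator decreases it.
ℓ-isLength : ∀ {n} (σ : SignedPerm n) (g : Sgn n → Sgn n) → (∀ z → apply σ (g z) ≡ z) → (∀ z → g (apply σ z) ≡ z) →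
             ∀ m → IsLength g m → ℓ σ ≡ ℤ.+ m
ℓ-isLength σ g σ∘g g∘σ m ((w , length≡m , represents) , minimal) = ℤₚ.≤-antisym upper lower
  where
    evaluates : ∀ z → evalInverse w z ≡ apply σ z
    evaluates z = trans (cong (evalInverse w) (sym (trans (represents (apply σ z)) (g∘σ z)))) (evalInverse-evalW w (apply σ z))
    upper : ℓ σ ℤ.≤ ℤ.+ m
    upper = ℤₚ.≤-trans (ℤₚ.≤-reflexive (ℓ-cong σ (wordPerm w) (sym ∘ evaluates ∘ pos)))
                       (subst (λ l → ℓ (wordPerm w) ℤ.≤ ℤ.+ l) length≡m (ℓ-wordPerm-≤ w))
    ℓ≡∣ℓ∣ : ℓ σ ≡ ℤ.+ ℤ.∣ ℓ σ ∣
    ℓ≡∣ℓ∣ = sym (ℤₚ.0≤i⇒+∣i∣≡i (inversionNumber-nonneg (window σ)))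
    lower : ℤ.+ m ℤ.≤ ℓ σ
    lower with reducedWord ℤ.∣ ℓ σ ∣ σ ℓ≡∣ℓ∣
    ... | w′ , length≡ , evaluates′ =
      subst (ℤ.+ m ℤ.≤_) (sym ℓ≡∣ℓ∣) (ℤ.+≤+ (subst (m ≤_) length≡ (minimal w′ represents′)))
      where
        represents′ : Represents w′ g
        represents′ x = trans (cong (evalW w′) (trans (sym (σ∘g x)) (sym (evaluates′ (g x))))) (evalW-evalInverse w′ (g x))

-- Edges of Γ among three elements of π[n]

inverseOf : ∀ {n} → Bn n → SignedPerm n
inverseOf π = record
  { apply = inv π
  ; apply-odd = λ z → trans (cong (inv π) (trans (cong minus (sym (inv-l π z))) (sym (odd π (inv π z))))) (inv-r π (minus (inv π z)))
  ; apply-injective = λ {z} {w} e → trans (sym (inv-l π z)) (trans (cong (fun π) e) (inv-l π w)) }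

ℓ-adjacent : ∀ {n} (π : Bn n) {x y : Sgn n} (x≢y : x ≢ y) → Adj π x y →
             ℓ (composeU (inverseOf π) x y x≢y) - ℓ (inverseOf π) ≡ -1ℤ
ℓ-adjacent π {x} {y} x≢y (_ , _ , k , isLength-π , isLength-uπ) = begin
  ℓ (composeU (inverseOf π) x y x≢y) - ℓ (inverseOf π)  ≡⟨ cong₂ _-_ ℓ-uπ ℓ-π ⟩
  ℤ.+ k - ℤ.+ suc k                                      ≡⟨ cong (ℤ.+ k -_) (ℤₚ.pos-+ 1 k) ⟩
  ℤ.+ k - (1ℤ + ℤ.+ k)                                   ≡⟨ drop (ℤ.+ k) ⟩
  -1ℤ                                                    ∎
  where
    open ≡-Reasoning
    drop : ∀ a → a - (1ℤ + a) ≡ -1ℤ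
    drop = solve-∀
    ℓ-π : ℓ (inverseOf π) ≡ ℤ.+ suc k
    ℓ-π = ℓ-isLength (inverseOf π) (fun π) (inv-r π) (inv-l π) (suc k) isLength-π
    ℓ-uπ : ℓ (composeU (inverseOf π) x y x≢y) ≡ ℤ.+ k
    ℓ-uπ = ℓ-isLength (composeU (inverseOf π) x y x≢y) (u x y ∘ fun π)
             (λ z → trans (cong (inv π) (u-involutive x y x≢y (fun π z))) (inv-r π z))
             (λ z → trans (cong (u x y) (inv-l π (u x y z))) (u-involutive x y x≢y z))
             k isLength-uπ

indicator : Bool → ℕ
indicator b = if b then 1 else 0

signedLeB : (sa sb a<b b<a : Bool) → Bool
signedLeB true true a<b _ = a<b
signedLeB true false _ _ = false
signedLeB false true _ _ = true
signedLeB false false _ b<a = b<a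

-- Bounds for the terms at (x, y) and at (x, x) of the sum, from the descent conditions at the third element.
pairBoundB : Cmp₃ → Cmp₃ → (sx sy sr : Bool) → ℕ
pairBoundB P@(x<y , y<x , _) M sx sy sr =
  if signedLeB sx sy x<y y<x
  then indicator (swapDescentB (sx xor sy) P M sx sy sr) ℕ.+ indicator ((sx xor sy) ∧ swapDescentB false P M sx sy sr)
  else 0

diagonalBoundB : Cmp₃ → Cmp₃ → (sx sy sz : Bool) → ℕ
diagonalBoundB (x<y , y<x , x<z , z<x , _) (a<b , b<a , a<c , c<a , _) sx sy sz =
  indicator (negDescentB (x<y , y<x) (a<b , b<a) (x<z , z<x) (a<c , c<a) sx sy sz)

as-bac as-acb as-bca as-cab as-cba : Cmp₃ → Cmp₃
as-bac (ab , ba , ac , ca , bc , cb) = (ba , ab , bc , cb , ac , ca)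
as-acb (ab , ba , ac , ca , bc , cb) = (ac , ca , ab , ba , cb , bc)
as-bca (ab , ba , ac , ca , bc , cb) = (bc , cb , ba , ab , ca , ac)
as-cab (ab , ba , ac , ca , bc , cb) = (ca , ac , cb , bc , ab , ba)
as-cba (ab , ba , ac , ca , bc , cb) = (cb , bc , ca , ac , ba , ab)

tripleBoundB : Cmp₃ → Cmp₃ → (sa sb sc : Bool) → ℕ
tripleBoundB P M sa sb sc =
  diagonalBoundB P M sa sb sc ℕ.+
  (pairBoundB P M sa sb sc ℕ.+
  (pairBoundB (as-acb P) (as-acb M) sa sc sb ℕ.+
  (pairBoundB (as-bac P) (as-bac M) sb sa sc ℕ.+
  (diagonalBoundB (as-bac P) (as-bac M) sb sa sc ℕ.+
  (pairBoundB (as-bca P) (as-bca M) sb sc sa ℕ.+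
  (pairBoundB (as-cab P) (as-cab M) sc sa sb ℕ.+
  (pairBoundB (as-cba P) (as-cba M) sc sb sa ℕ.+
  (diagonalBoundB (as-cba P) (as-cba M) sc sb sa ℕ.+ 0))))))))

tripleBoundB-≤4 : ∀ o₁ o₂ sa sb sc → tripleBoundB (pattern₃ o₁) (pattern₃ o₂) sa sb sc ≤ 4
tripleBoundB-≤4 = toWitness {a? = ∀-Order₃? λ o₁ → ∀-Order₃? λ o₂ → ∀-Bool? λ sa → ∀-Bool? λ sb → ∀-Bool? λ sc →
  tripleBoundB (pattern₃ o₁) (pattern₃ o₂) sa sb sc ℕ.≤? 4} tt

record Image {n} (π : Bn n) : Set where
  constructor image
  field
    s : Bool
    X : Fin n
    P : Fin n
    maps : fun π (pos P) ≡ signed s X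

value : ∀ {n} {π : Bn n} → Image π → Sgn n
value a = signed (Image.s a) (Image.X a)

inv-image : ∀ {n} (π : Bn n) {z w} → fun π z ≡ w → inv π w ≡ z
inv-image π {z} e = trans (cong (inv π) (sym e)) (inv-r π z)

inv-image-minus : ∀ {n} (π : Bn n) {P x} → fun π (pos P) ≡ x → inv π (minus x) ≡ neg P
inv-image-minus π {P} maps = inv-image π (trans (odd π (pos P)) (cong minus maps))

window-image : ∀ {n} {π : Bn n} (a : Image π) → window (inverseOf π) (Image.X a) ≡ (Image.s a , Image.P a)
window-image {π = π} (image true X P maps) = cong toSigned (inv-image π maps)
window-image {π = π} (image false X P maps) = cong toSigned (inv-image-minus π maps)

toImage : ∀ {n} (π : Bn n) x → InImage π x → Image π
toImage π x (P , maps) = image (sign x) (magnitude x) P (trans maps (signed-toSigned x))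

value-toImage : ∀ {n} (π : Bn n) x (x∈π : InImage π x) → value (toImage π x x∈π) ≡ x
value-toImage π x _ = sym (signed-toSigned x)

image-X-injective : ∀ {n} {π : Bn n} (a b : Image π) → value a ≢ value b → Image.X a ≢ Image.X b
image-X-injective (image true X Pa ha) (image true .X Pb hb) a≢b refl = a≢b refl
image-X-injective (image false X Pa ha) (image false .X Pb hb) a≢b refl = a≢b refl
image-X-injective {π = π} (image true X Pa ha) (image false .X Pb hb) _ refl
  with () ← trans (sym (inv-image π ha)) (inv-image-minus π hb)
image-X-injective {π = π} (image false X Pa ha) (image true .X Pb hb) _ refl
  with () ← trans (sym (inv-image π ha)) (inv-image-minus π hb)

image-P-injective : ∀ {n} {π : Bn n} (a b : Image π) → value a ≢ value b → Image.P a ≢ Image.P b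
image-P-injective (image sa A P ha) (image sb B .P hb) a≢b refl = a≢b (trans (sym ha) hb)

if-mono : ∀ {b b′ : Bool} {p q : ℕ} → b ≡ b′ → p ≤ q → (if b then p else 0) ≤ (if b′ then q else 0)
if-mono {true} refl p≤q = p≤q
if-mono {false} refl _ = z≤n

indicator-≤ : ∀ {A : Set} {c} (d : Dec A) → (A → T c) → indicator (does d) ≤ indicator c
indicator-≤ {c = true} (yes _) _ = ℕₚ.≤-refl
indicator-≤ {c = false} (yes a) h = ⊥-elim (h a)
indicator-≤ (no _) _ = z≤n

indicator-zero : ∀ {A : Set} (d : Dec A) → ¬ A → indicator (does d) ≤ 0
indicator-zero (yes a) ¬a = ⊥-elim (¬a a)
indicator-zero (no _) _ = z≤n

indicator-≤1 : ∀ b → indicator b ≤ 1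
indicator-≤1 true = ℕₚ.≤-refl
indicator-≤1 false = z≤n

excluded-middleᵇ : ∀ b → T (not b ∨ b)
excluded-middleᵇ true = tt
excluded-middleᵇ false = tt

≤-signed : ∀ {n} sx sy {X Y : Fin n} → X ≢ Y → does (toℤ (signed sx X) ℤ.≤? toℤ (signed sy Y)) ≡ signedLeB sx sy (X <ᶠ Y) (Y <ᶠ X)
≤-signed true false {X} {Y} _ = dec-false (toℤ (pos X) ℤ.≤? toℤ (neg Y)) λ ()
≤-signed false true {X} {Y} _ = dec-true (toℤ (neg X) ℤ.≤? toℤ (pos Y)) ℤ.-≤+
≤-signed true true {X} {Y} X≢Y with ℕₚ.<-cmp (toℕ X) (toℕ Y)
... | tri< X<Y _ _ = trans (dec-true (toℤ (pos X) ℤ.≤? toℤ (pos Y)) (ℤ.+≤+ (s≤s (ℕₚ.<⇒≤ X<Y)))) (sym (<ᵇ-true X<Y))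
... | tri≈ _ X≡Y _ = ⊥-elim (X≢Y (Finₚ.toℕ-injective X≡Y))
... | tri> _ _ Y<X = trans (dec-false (toℤ (pos X) ℤ.≤? toℤ (pos Y))
                                     λ { (ℤ.+≤+ (s≤s X≤Y)) → ℕₚ.<-irrefl refl (ℕₚ.<-≤-trans Y<X X≤Y) })
                          (sym (<ᵇ-false (ℕₚ.<⇒≤ Y<X)))
≤-signed false false {X} {Y} X≢Y with ℕₚ.<-cmp (toℕ X) (toℕ Y)
... | tri< X<Y _ _ = trans (dec-false (toℤ (neg X) ℤ.≤? toℤ (neg Y))
                                     λ { (ℤ.-≤- Y≤X) → ℕₚ.<-irrefl refl (ℕₚ.<-≤-trans X<Y Y≤X) })
                          (sym (<ᵇ-false (ℕₚ.<⇒≤ X<Y)))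
... | tri≈ _ X≡Y _ = ⊥-elim (X≢Y (Finₚ.toℕ-injective X≡Y))
... | tri> _ _ Y<X = trans (dec-true (toℤ (neg X) ℤ.≤? toℤ (neg Y)) (ℤ.-≤- (ℕₚ.<⇒≤ Y<X))) (sym (<ᵇ-true Y<X))

toℤ-injective : ∀ {n} {x y : Sgn n} → toℤ x ≡ toℤ y → x ≡ y
toℤ-injective {x = pos i} {pos j} e = cong pos (Finₚ.toℕ-injective (ℕₚ.suc-injective (ℤₚ.+-injective e)))
toℤ-injective {x = neg i} {neg j} e = cong neg (Finₚ.toℕ-injective (ℤₚ.-[1+-injective e))
toℤ-injective {x = pos i} {neg j} ()
toℤ-injective {x = neg i} {pos j} ()

¬pos-neg : ∀ {n} (p q : Fin n) → ¬ (0ℤ ℤ.< toℤ (pos p) ℤ.* toℤ (neg q))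
¬pos-neg p q ()

¬neg-pos : ∀ {n} (p q : Fin n) → ¬ (0ℤ ℤ.< toℤ (neg p) ℤ.* toℤ (pos q))
¬neg-pos p q ()

keep : ∀ {n} {x y : Sgn n} ys → x ≢ y → filter (¬? ∘ _≟S_ x) (y ∷ ys) ≡ y ∷ filter (¬? ∘ _≟S_ x) ys
keep {x = x} ys x≢y = Listₚ.filter-accept (¬? ∘ _≟S_ x) x≢y

drop : ∀ {n} {x y : Sgn n} ys → x ≡ y → filter (¬? ∘ _≟S_ x) (y ∷ ys) ≡ filter (¬? ∘ _≟S_ x) ys
drop {x = x} ys x≡y = Listₚ.filter-reject (¬? ∘ _≟S_ x) (λ x≢y → x≢y x≡y)

module TripleBound {n} (π : Bn n) (adj? : ∀ x y → Dec (Adj π x y)) where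

  open Image

  private
    σ : SignedPerm n
    σ = inverseOf π

  term : Sgn n → Sgn n → ℕ
  term x y = if does (toℤ x ℤ.≤? toℤ y) then α {π = π} adj? x y else 0

  pairSum : List (Sgn n) → ℕ
  pairSum S = sumℕ (concatMap (λ x → map (λ y → term x y) S) S)

  swap-descent : ∀ (a b r : Image π) sx sy (Xa≢Xb : X a ≢ X b) → X r ≢ X a → X r ≢ X b →
                 Admissible (sx xor sy) (s a) (s b) → Adj π (signed sx (X a)) (signed sy (X b)) →
                 T (swapDescentB (sx xor sy) (compare₃ (X a) (X b) (X r)) (compare₃ (P a) (P b) (P r)) (s a) (s b) (s r))
  swap-descent a b r sx sy Xa≢Xb Xr≢Xa Xr≢Xb admissible adj =
    subst T (cong₃ (λ wa wb wr → swapDescentB (sx xor sy) (compare₃ (X a) (X b) (X r)) (compare₃ (proj₂ wa) (proj₂ wb) (proj₂ wr))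
                                              (proj₁ wa) (proj₁ wb) (proj₁ wr))
                   (window-image a) (window-image b) (window-image r))
      (SwapChange.descentB σ sx sy Xa≢Xb admissible′ (ℓ-adjacent π (signed-≢ sx sy Xa≢Xb) adj) (X r) Xr≢Xa Xr≢Xb)
    where
      admissible′ : Admissible (sx xor sy) (windowSign σ (X a)) (windowSign σ (X b))
      admissible′ = subst₂ (λ sa sb → T (not (sx xor sy) ∨ (sa xor sb)))
                           (sym (cong proj₁ (window-image a))) (sym (cong proj₁ (window-image b))) admissible

  e-swap : ∀ (a b r : Image π) → X a ≢ X b → X r ≢ X a → X r ≢ X b →
           e {π = π} adj? (value a) (value b)
           ≤ indicator (swapDescentB (s a xor s b) (compare₃ (X a) (X b) (X r)) (compare₃ (P a) (P b) (P r)) (s a) (s b) (s r))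
  e-swap a b r Xa≢Xb Xr≢Xa Xr≢Xb =
    indicator-≤ (adj? (value a) (value b)) (swap-descent a b r (s a) (s b) Xa≢Xb Xr≢Xa Xr≢Xb (excluded-middleᵇ (s a xor s b)))

  -- For x, y ∈ π[n] of the same sign both x(-y) and π⁻¹(x)π⁻¹(-y) are negative, so u_{x,-y} is undefined.
  ¬adjacent-minus : ∀ (a b : Image π) → s a ≡ s b → X a ≢ X b → ¬ Adj π (value a) (minus (value b))
  ¬adjacent-minus (image true Xa Pa ha) (image true Xb Pb hb) refl Xa≢Xb (_ , inj₁ e , _) = Xa≢Xb (cong magnitude e)
  ¬adjacent-minus (image true Xa Pa ha) (image true Xb Pb hb) refl _ (_ , inj₂ (inj₁ product>0) , _) = ¬pos-neg Xa Xb product>0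
  ¬adjacent-minus (image true Xa Pa ha) (image true Xb Pb hb) refl _ (_ , inj₂ (inj₂ product>0) , _) =
    ¬pos-neg Pa Pb (subst₂ (λ x y → 0ℤ ℤ.< toℤ x ℤ.* toℤ y) (inv-image π ha) (inv-image-minus π hb) product>0)
  ¬adjacent-minus (image false Xa Pa ha) (image false Xb Pb hb) refl Xa≢Xb (_ , inj₁ e , _) = Xa≢Xb (cong magnitude e)
  ¬adjacent-minus (image false Xa Pa ha) (image false Xb Pb hb) refl _ (_ , inj₂ (inj₁ product>0) , _) = ¬neg-pos Xa Xb product>0
  ¬adjacent-minus (image false Xa Pa ha) (image false Xb Pb hb) refl _ (_ , inj₂ (inj₂ product>0) , _) =
    ¬pos-neg Pa Pb (subst₂ (λ x y → 0ℤ ℤ.< toℤ x ℤ.* toℤ y) (inv-image π ha) (inv-image-minus π hb) product>0)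

  e-swap-minus : ∀ (a b r : Image π) → X a ≢ X b → X r ≢ X a → X r ≢ X b →
                 e {π = π} adj? (value a) (minus (value b))
                 ≤ indicator ((s a xor s b) ∧ swapDescentB false (compare₃ (X a) (X b) (X r)) (compare₃ (P a) (P b) (P r)) (s a) (s b) (s r))
  e-swap-minus a@(image true _ _ _) b@(image true _ _ _) r Xa≢Xb _ _ = indicator-zero (adj? _ _) (¬adjacent-minus a b refl Xa≢Xb)
  e-swap-minus a@(image false _ _ _) b@(image false _ _ _) r Xa≢Xb _ _ = indicator-zero (adj? _ _) (¬adjacent-minus a b refl Xa≢Xb)
  e-swap-minus a@(image true _ _ _) b@(image false _ _ _) r Xa≢Xb Xr≢Xa Xr≢Xb =
    indicator-≤ (adj? _ _) (swap-descent a b r true true Xa≢Xb Xr≢Xa Xr≢Xb tt)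
  e-swap-minus a@(image false _ _ _) b@(image true _ _ _) r Xa≢Xb Xr≢Xa Xr≢Xb =
    indicator-≤ (adj? _ _) (swap-descent a b r false false Xa≢Xb Xr≢Xa Xr≢Xb tt)

  e-minus-self : ∀ (a b c : Image π) → X b ≢ X a → X c ≢ X a →
                 e {π = π} adj? (value a) (minus (value a))
                 ≤ indicator (negDescentB (compare₂ (X a) (X b)) (compare₂ (P a) (P b)) (compare₂ (X a) (X c)) (compare₂ (P a) (P c)) (s a) (s b) (s c))
  e-minus-self a b c Xb≢Xa Xc≢Xa = indicator-≤ (adj? _ _) λ adj →
    subst T (cong₃ (λ wa wb wc → negDescentB (compare₂ (X a) (X b)) (compare₂ (proj₂ wa) (proj₂ wb)) (compare₂ (X a) (X c)) (compare₂ (proj₂ wa) (proj₂ wc))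
                                             (proj₁ wa) (proj₁ wb) (proj₁ wc))
                   (window-image a) (window-image b) (window-image c))
      (NegChange.descentB σ (s a) (X a) (ℓ-adjacent π (x≢minus-x (value a)) adj) (X b) (X c) Xb≢Xa Xc≢Xa)

  diagonal-bound : ∀ (a b c : Image π) → X b ≢ X a → X c ≢ X a →
                   term (value a) (value a) ≤ diagonalBoundB (compare₃ (X a) (X b) (X c)) (compare₃ (P a) (P b) (P c)) (s a) (s b) (s c)
  diagonal-bound a b c Xb≢Xa Xc≢Xa =
    ℕₚ.≤-trans (if-≤ (does (toℤ (value a) ℤ.≤? toℤ (value a))))
               (ℕₚ.+-mono-≤ (indicator-zero (adj? (value a) (value a)) λ adj → proj₁ adj refl) (e-minus-self a b c Xb≢Xa Xc≢Xa))
    where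
      if-≤ : ∀ b {p} → (if b then p else 0) ≤ p
      if-≤ true = ℕₚ.≤-refl
      if-≤ false = z≤n

  pair-bound : ∀ (a b r : Image π) → X a ≢ X b → X r ≢ X a → X r ≢ X b →
               term (value a) (value b) ≤ pairBoundB (compare₃ (X a) (X b) (X r)) (compare₃ (P a) (P b) (P r)) (s a) (s b) (s r)
  pair-bound a b r Xa≢Xb Xr≢Xa Xr≢Xb =
    if-mono (≤-signed (s a) (s b) Xa≢Xb) (ℕₚ.+-mono-≤ (e-swap a b r Xa≢Xb Xr≢Xa Xr≢Xb) (e-swap-minus a b r Xa≢Xb Xr≢Xa Xr≢Xb))

  pairSum-distinct₃ : ∀ (a b c : Image π) → value a ≢ value b → value a ≢ value c → value b ≢ value c →
                      pairSum (value a ∷ value b ∷ value c ∷ []) ≤ 4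
  pairSum-distinct₃ a b c a≢b a≢c b≢c = ℕₚ.≤-trans termwise
    (at-order₃ {P = λ M → tripleBoundB (compare₃ (X a) (X b) (X c)) M (s a) (s b) (s c) ≤ 4}
      (λ o₂ → at-order₃ {P = λ M → tripleBoundB M (pattern₃ o₂) (s a) (s b) (s c) ≤ 4}
                (λ o₁ → tripleBoundB-≤4 o₁ o₂ (s a) (s b) (s c)) Xa≢Xb Xa≢Xc Xb≢Xc)
      (image-P-injective a b a≢b) (image-P-injective a c a≢c) (image-P-injective b c b≢c))
    where
      Xa≢Xb : X a ≢ X b
      Xa≢Xb = image-X-injective a b a≢b
      Xa≢Xc : X a ≢ X c
      Xa≢Xc = image-X-injective a c a≢c
      Xb≢Xc : X b ≢ X c
      Xb≢Xc = image-X-injective b c b≢c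
      termwise : pairSum (value a ∷ value b ∷ value c ∷ [])
                 ≤ tripleBoundB (compare₃ (X a) (X b) (X c)) (compare₃ (P a) (P b) (P c)) (s a) (s b) (s c)
      termwise =
        ℕₚ.+-mono-≤ (diagonal-bound a b c (≢-sym Xa≢Xb) (≢-sym Xa≢Xc))
        (ℕₚ.+-mono-≤ (pair-bound a b c Xa≢Xb (≢-sym Xa≢Xc) (≢-sym Xb≢Xc))
        (ℕₚ.+-mono-≤ (pair-bound a c b Xa≢Xc (≢-sym Xa≢Xb) Xb≢Xc)
        (ℕₚ.+-mono-≤ (pair-bound b a c (≢-sym Xa≢Xb) (≢-sym Xb≢Xc) (≢-sym Xa≢Xc))
        (ℕₚ.+-mono-≤ (diagonal-bound b a c Xa≢Xb (≢-sym Xb≢Xc))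
        (ℕₚ.+-mono-≤ (pair-bound b c a Xb≢Xc Xa≢Xb Xa≢Xc)
        (ℕₚ.+-mono-≤ (pair-bound c a b (≢-sym Xa≢Xc) Xb≢Xc (≢-sym Xa≢Xb))
        (ℕₚ.+-mono-≤ (pair-bound c b a (≢-sym Xb≢Xc) Xa≢Xc Xa≢Xb)
        (ℕₚ.+-mono-≤ (diagonal-bound c b a Xb≢Xc Xa≢Xc) z≤n))))))))

  α-≤2 : ∀ x y → α {π = π} adj? x y ≤ 2
  α-≤2 x y = ℕₚ.+-mono-≤ (indicator-≤1 (does (adj? x y))) (indicator-≤1 (does (adj? x (minus y))))

  term-diagonal-≤1 : ∀ x → term x x ≤ 1
  term-diagonal-≤1 x with does (toℤ x ℤ.≤? toℤ x)
  ... | true = ℕₚ.+-mono-≤ (indicator-zero (adj? x x) λ adj → proj₁ adj refl) (indicator-≤1 (does (adj? x (minus x))))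
  ... | false = z≤n

  term-pair-≤2 : ∀ {x y} → x ≢ y → term x y ℕ.+ term y x ≤ 2
  term-pair-≤2 {x} {y} x≢y with toℤ x ℤ.≤? toℤ y | toℤ y ℤ.≤? toℤ x
  ... | yes x≤y | yes y≤x = ⊥-elim (x≢y (toℤ-injective (ℤₚ.≤-antisym x≤y y≤x)))
  ... | yes _ | no _ = subst (_≤ 2) (sym (ℕₚ.+-identityʳ _)) (α-≤2 x y)
  ... | no _ | yes _ = α-≤2 y x
  ... | no _ | no _ = z≤n

  pairSum-distinct₂ : ∀ {x y} → x ≢ y → pairSum (x ∷ y ∷ []) ≤ 4
  pairSum-distinct₂ {x} {y} x≢y =
    ℕₚ.+-mono-≤ (term-diagonal-≤1 x)
      (subst (_≤ 3) (ℕₚ.+-assoc (term x y) (term y x) (term y y ℕ.+ 0))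
        (ℕₚ.+-mono-≤ (term-pair-≤2 x≢y) (ℕₚ.+-mono-≤ (term-diagonal-≤1 y) z≤n)))

  pairSum-single : ∀ x → pairSum (x ∷ []) ≤ 4
  pairSum-single x = ℕₚ.≤-trans (ℕₚ.+-mono-≤ (term-diagonal-≤1 x) (z≤n {0})) (s≤s z≤n)

  pairSum-deduplicate : ∀ {a b c} → InImage π a → InImage π b → InImage π c → Dec (b ≡ c) → Dec (a ≡ b) → Dec (a ≡ c) →
                        pairSum (deduplicate _≟S_ (a ∷ b ∷ c ∷ [])) ≤ 4
  pairSum-deduplicate {a} {b} {c} a∈π b∈π c∈π (no b≢c) (no a≢b) (no a≢c) =
    subst (λ S → pairSum S ≤ 4)
          (trans (cong₃ (λ x y z → x ∷ y ∷ z ∷ []) (value-toImage π a a∈π) (value-toImage π b b∈π) (value-toImage π c c∈π))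
                 (sym (trans (cong (λ l → a ∷ filter (¬? ∘ _≟S_ a) (b ∷ l)) (keep [] b≢c))
                             (cong (a ∷_) (trans (keep (c ∷ []) a≢b) (cong (b ∷_) (keep [] a≢c)))))))
          (pairSum-distinct₃ (toImage π a a∈π) (toImage π b b∈π) (toImage π c c∈π)
                             (distinct a≢b (value-toImage π a a∈π) (value-toImage π b b∈π))
                             (distinct a≢c (value-toImage π a a∈π) (value-toImage π c c∈π))
                             (distinct b≢c (value-toImage π b b∈π) (value-toImage π c c∈π)))
    where
      distinct : ∀ {x y x′ y′ : Sgn n} → x ≢ y → x′ ≡ x → y′ ≡ y → x′ ≢ y′
      distinct x≢y refl refl = x≢y
  pairSum-deduplicate _ _ _ (no b≢c) (yes a≡b) (yes a≡c) = ⊥-elim (b≢c (trans (sym a≡b) a≡c))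
  pairSum-deduplicate {a} {b} {c} _ _ _ (no b≢c) (yes a≡b) (no a≢c) =
    subst (λ S → pairSum S ≤ 4)
          (sym (trans (cong (λ l → a ∷ filter (¬? ∘ _≟S_ a) (b ∷ l)) (keep [] b≢c))
                      (cong (a ∷_) (trans (drop (c ∷ []) a≡b) (keep [] a≢c)))))
          (pairSum-distinct₂ a≢c)
  pairSum-deduplicate {a} {b} {c} _ _ _ (no b≢c) (no a≢b) (yes a≡c) =
    subst (λ S → pairSum S ≤ 4)
          (sym (trans (cong (λ l → a ∷ filter (¬? ∘ _≟S_ a) (b ∷ l)) (keep [] b≢c))
                      (cong (a ∷_) (trans (keep (c ∷ []) a≢b) (cong (b ∷_) (drop [] a≡c))))))
          (pairSum-distinct₂ a≢b)
  pairSum-deduplicate {a} {b} {c} _ _ _ (yes b≡c) (no a≢b) _ =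
    subst (λ S → pairSum S ≤ 4)
          (sym (trans (cong (λ l → a ∷ filter (¬? ∘ _≟S_ a) (b ∷ l)) (drop [] b≡c)) (cong (a ∷_) (keep [] a≢b))))
          (pairSum-distinct₂ a≢b)
  pairSum-deduplicate {a} {b} {c} _ _ _ (yes b≡c) (yes a≡b) _ =
    subst (λ S → pairSum S ≤ 4)
          (sym (trans (cong (λ l → a ∷ filter (¬? ∘ _≟S_ a) (b ∷ l)) (drop [] b≡c)) (cong (a ∷_) (drop [] a≡b))))
          (pairSum-single a)

mainTheorem6 : (n : ℕ) → 1 ≤ n → (π : Bn n) → (adj? : ∀ x y → Dec (Adj π x y))
    → (a b c : Sgn n) → InImage π a → InImage π b → InImage π c
    → tripleSum {π = π} adj? a b c ≤ 4
mainTheorem6 n _ π adj? a b c a∈π b∈π c∈π =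
  TripleBound.pairSum-deduplicate π adj? a∈π b∈π c∈π (b ≟S c) (a ≟S b) (a ≟S c)
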